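{- For $n\ge 0$ let $f(n)$ be the number of distinct words of length $2n$ that are factors of the Thue–Morse word $\mathbf t$ and are abelian squares (for $n=0$ the empty word is counted, so $f(0)=1$). Let $v=[1,0,0,0,0,0,0,0,0,0,0]$, $w=[1,2,4,4,10,8,24,10,22,12,36]^T$, $$M_0=\begin{pmatrix} 1&0&0&0&0&0&0&0&0&0&0\\ 0&0&1&0&0&0&0&0&0&0&0\\ 0&0&0&0&1&0&0&0&0&0&0\\ 0&0&0&0&0&0&1&0&0&0&0\\ 0&0&0&0&0&0&0&0&1&0&0\\ 0&0&0&0&0&0&0&0&0&0&1\\ 0&0&\frac{64}{13}&1&-\frac{171}{26}&-\frac{69}{26}&0&0&\frac{43}{26}&\frac{9}{13}&\frac{51}{26}\\ 0&0&\frac{90}{13}&-1&-\frac{275}{26}&\frac{9}{26}&0&2&\frac{69}{26}&-\frac{17}{13}&\frac{51}{26}\\ 0&0&-2&0&1&0&0&0&2&0&0\\ 0&0&\frac{68}{13}&0&-\frac{88}{13}&-\frac{33}{13}&0&0&\frac{20}{13}&\frac{12}{13}&\frac{34}{13}\\ 0&0&\frac{54}{13}&0&-\frac{89}{13}&-\frac{22}{13}&0&0&\frac{35}{13}&\frac{8}{13}&\frac{27}{13} \end{pmatrix},$$ $$M_1=\begin{pmatrix} 0&1&0&0&0&0&0&0&0&0&0\\ 0&0&0&1&0&0&0&0&0&0&0\\ 0&0&0&0&0&1&0&0&0&0&0\\ 0&0&0&0&0&0&0&1&0&0&0\\ 0&0&0&0&0&0&0&0&0&1&0\\ 0&0&-\frac{8}{13}&0&-\frac{8}{13}&\frac{10}{13}&0&0&\frac{16}{13}&\frac{7}{13}&-\frac{4}{13}\\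 0&0&-\frac{87}{13}&-1&\frac{203}{26}&\frac{3}{26}&2&0&-\frac{3}{26}&\frac{16}{13}&-\frac{61}{26}\\ 0&0&-\frac{7}{13}&1&\frac{25}{26}&-\frac{93}{26}&0&0&\frac{15}{26}&\frac{37}{13}&-\frac{7}{26}\\ 0&0&\frac{20}{13}&0&-\frac{45}{13}&-\frac{12}{13}&0&0&\frac{25}{13}&\frac{28}{13}&-\frac{3}{13}\\ 0&0&-\frac{40}{13}&0&\frac{25}{13}&-\frac{2}{13}&0&0&\frac{15}{13}&\frac{22}{13}&-\frac{7}{13}\\ 0&0&-\frac{36}{13}&0&\frac{29}{13}&-\frac{20}{13}&0&0&\frac{7}{13}&\frac{38}{13}&-\frac{5}{13} \end{pmatrix}.$$ Then for every $n\ge 0$, if $a_1a_2\cdots a_i$ is the base-$2$ representation of $n$ (most significant digit first), one has $f(n)=vM_{a_1}M_{a_2}\cdots M_{a_i}w$. In particular $f$ is $2$-regular.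
   Context: The Thue–Morse word $\mathbf t=0110100110010110\cdots$ is the fixed point starting with $0$ of the morphism $\mu:0\mapsto 01,\ 1\mapsto 10$. An abelian square is a word $uv$ where $v$ is an anagram of $u$ (same number of each letter). The base-$2$ representation of $n$ is taken without leading zeros, with $0$ represented by the empty word (leading zeros do not affect the product since the first row of $M_0$ is $v$). A sequence is $2$-regular if it admits such a linear representation. -}

module Defs where

open import Data.Bool using (Bool; true; false; not; _≟_; if_then_else_)
open import Relation.Nullary.Decidable using (isYes)
open import Data.Nat using (ℕ; zero; suc; _+_; _*_; NonZero)
open import Data.Integer using (ℤ; +_)
open import Data.Rational using (ℚ; _/_; -_; 0ℚ; 1ℚ) renaming (_+_ to _+q_; _*_ to _*q_)
open import Data.Fin using (Fin; toℕ)
open import Data.List using (List; []; _∷_; _++_; concatMap; length; applyUpTo; foldl)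
open import Data.Vec using (Vec; []; _∷_; lookup; tabulate; foldr)
open import Data.Product using (Σ; _×_; ∃)
open import Relation.Binary.PropositionalEquality using (_≡_)

-- Words over {0,1}; letter 0 is false, letter 1 is true.

Word : Set
Word = List Bool

μ₁ : Bool → Word
μ₁ false = false ∷ true ∷ []
μ₁ true  = true ∷ false ∷ []

μ : Word → Word
μ = concatMap μ₁

μ^ : ℕ → Word → Word
μ^ zero    u = u
μ^ (suc k) u = μ (μ^ k u)

-- i-th letter of a finite word (default false when out of range; never
-- used below, since μ^(i+1)(0) has length 2^(i+1) > i).
nth : Word → ℕ → Bool
nth []      _       = false
nth (a ∷ u) zero    = a
nth (a ∷ u) (suc i) = nth u i

-- The Thue–Morse word t, the fixed point of μ starting with 0:
-- t i is the i-th letter of the prefix μ^(i+1)(0).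
t : ℕ → Bool
t i = nth (μ^ (suc i) (false ∷ [])) i

Factor : Word → Set
Factor u = ∃ λ i → u ≡ applyUpTo (λ j → t (i + j)) (length u)

occ : Bool → Word → ℕ
occ a []      = 0
occ a (b ∷ u) = if isYes (b ≟ a) then suc (occ a u) else occ a u

AbelianSquare : Word → Set
AbelianSquare u = Σ Word λ x → Σ Word λ y →
  (u ≡ x ++ y) × ((a : Bool) → occ a x ≡ occ a y)

Counted : ℕ → Word → Set
Counted n u = (length u ≡ 2 * n) × Factor u × AbelianSquare u

-- Base-2 representation: digits most significant first, no leading zeros,
-- 0 represented by the empty word.

value : List (Fin 2) → ℕ
value = foldl (λ acc d → 2 * acc + toℕ d) 0

NoLeadingZero : List (Fin 2) → Set
NoLeadingZero []      = Data.Unit.⊤ where import Data.Unit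
NoLeadingZero (d ∷ _) = toℕ d ≡ 1

IsBase2Rep : List (Fin 2) → ℕ → Set
IsBase2Rep ds n = (value ds ≡ n) × NoLeadingZero ds

Mat : Set
Mat = Vec (Vec ℚ 11) 11

RowV : Set
RowV = Vec ℚ 11

dot : RowV → RowV → ℚ
dot u w = foldr (λ _ → ℚ) _+q_ 0ℚ (tabulate λ j → lookup u j *q lookup w j)

_·_ : RowV → Mat → RowV
u · M = tabulate λ j → dot u (tabulate λ i → lookup (lookup M i) j)

p : ℕ → (d : ℕ) → .{{NonZero d}} → ℚ
p n d = (+ n) / d

m : ℕ → (d : ℕ) → .{{NonZero d}} → ℚ
m n d = - ((+ n) / d)

z o : ℚ
z = 0ℚ
o = 1ℚ

vVec : RowV
vVec = o ∷ z ∷ z ∷ z ∷ z ∷ z ∷ z ∷ z ∷ z ∷ z ∷ z ∷ []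

wVec : RowV
wVec = p 1 1 ∷ p 2 1 ∷ p 4 1 ∷ p 4 1 ∷ p 10 1 ∷ p 8 1 ∷ p 24 1 ∷ p 10 1 ∷ p 22 1 ∷ p 12 1 ∷ p 36 1 ∷ []

M₀ : Mat
M₀ =
  (o ∷ z ∷ z ∷ z ∷ z ∷ z ∷ z ∷ z ∷ z ∷ z ∷ z ∷ []) ∷
  (z ∷ z ∷ o ∷ z ∷ z ∷ z ∷ z ∷ z ∷ z ∷ z ∷ z ∷ []) ∷
  (z ∷ z ∷ z ∷ z ∷ o ∷ z ∷ z ∷ z ∷ z ∷ z ∷ z ∷ []) ∷
  (z ∷ z ∷ z ∷ z ∷ z ∷ z ∷ o ∷ z ∷ z ∷ z ∷ z ∷ []) ∷
  (z ∷ z ∷ z ∷ z ∷ z ∷ z ∷ z ∷ z ∷ o ∷ z ∷ z ∷ []) ∷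
  (z ∷ z ∷ z ∷ z ∷ z ∷ z ∷ z ∷ z ∷ z ∷ z ∷ o ∷ []) ∷
  (z ∷ z ∷ p 64 13 ∷ o ∷ m 171 26 ∷ m 69 26 ∷ z ∷ z ∷ p 43 26 ∷ p 9 13 ∷ p 51 26 ∷ []) ∷
  (z ∷ z ∷ p 90 13 ∷ m 1 1 ∷ m 275 26 ∷ p 9 26 ∷ z ∷ p 2 1 ∷ p 69 26 ∷ m 17 13 ∷ p 51 26 ∷ []) ∷
  (z ∷ z ∷ m 2 1 ∷ z ∷ o ∷ z ∷ z ∷ z ∷ p 2 1 ∷ z ∷ z ∷ []) ∷
  (z ∷ z ∷ p 68 13 ∷ z ∷ m 88 13 ∷ m 33 13 ∷ z ∷ z ∷ p 20 13 ∷ p 12 13 ∷ p 34 13 ∷ []) ∷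
  (z ∷ z ∷ p 54 13 ∷ z ∷ m 89 13 ∷ m 22 13 ∷ z ∷ z ∷ p 35 13 ∷ p 8 13 ∷ p 27 13 ∷ []) ∷
  []

M₁ : Mat
M₁ =
  (z ∷ o ∷ z ∷ z ∷ z ∷ z ∷ z ∷ z ∷ z ∷ z ∷ z ∷ []) ∷
  (z ∷ z ∷ z ∷ o ∷ z ∷ z ∷ z ∷ z ∷ z ∷ z ∷ z ∷ []) ∷
  (z ∷ z ∷ z ∷ z ∷ z ∷ o ∷ z ∷ z ∷ z ∷ z ∷ z ∷ []) ∷
  (z ∷ z ∷ z ∷ z ∷ z ∷ z ∷ z ∷ o ∷ z ∷ z ∷ z ∷ []) ∷
  (z ∷ z ∷ z ∷ z ∷ z ∷ z ∷ z ∷ z ∷ z ∷ o ∷ z ∷ []) ∷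
  (z ∷ z ∷ m 8 13 ∷ z ∷ m 8 13 ∷ p 10 13 ∷ z ∷ z ∷ p 16 13 ∷ p 7 13 ∷ m 4 13 ∷ []) ∷
  (z ∷ z ∷ m 87 13 ∷ m 1 1 ∷ p 203 26 ∷ p 3 26 ∷ p 2 1 ∷ z ∷ m 3 26 ∷ p 16 13 ∷ m 61 26 ∷ []) ∷
  (z ∷ z ∷ m 7 13 ∷ o ∷ p 25 26 ∷ m 93 26 ∷ z ∷ z ∷ p 15 26 ∷ p 37 13 ∷ m 7 26 ∷ []) ∷
  (z ∷ z ∷ p 20 13 ∷ z ∷ m 45 13 ∷ m 12 13 ∷ z ∷ z ∷ p 25 13 ∷ p 28 13 ∷ m 3 13 ∷ []) ∷
  (z ∷ z ∷ m 40 13 ∷ z ∷ p 25 13 ∷ m 2 13 ∷ z ∷ z ∷ p 15 13 ∷ p 22 13 ∷ m 7 13 ∷ []) ∷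
  (z ∷ z ∷ m 36 13 ∷ z ∷ p 29 13 ∷ m 20 13 ∷ z ∷ z ∷ p 7 13 ∷ p 38 13 ∷ m 5 13 ∷ []) ∷
  []

M : Fin 2 → Mat
M Fin.zero       = M₀ where import Data.Fin as Fin
M (Fin.suc _)    = M₁ where import Data.Fin as Fin

vM : List (Fin 2) → RowV
vM = foldl (λ u d → u · M d) vVec

linRep : List (Fin 2) → ℚ
linRep ds = dot (vM ds) wVec

module Submission where

-- Proof.  (1) ThueMorse: t(2k) = t(k), t(2k+1) = ¬t(k), and t has no cube aaa.
-- (2) ConstrainedFactors: the factor of length L at position 2k+c is an expansion of the factor of
-- length ⌈(c+L)/2⌉ at k; letter constraints "u[0] ⊕ u[i] = b" transfer along the expansion, and
-- for L ≥ 4 the parity c is determined by the factor.  Hence the number of factors of length L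
-- satisfying C obeys count L C = Σ_c count ⌈(c+L)/2⌉ (shrink c C).
-- (3) AbelianSquares: a factor is an abelian square iff its halves have the same weight; this
-- expresses f(n) through constrained counts at half the length.
-- (4) AffineFamilies, AbelianSquareCount: constrained counts whose length and constraint positions
-- are affine in m satisfy a 2-kernel recursion; 26 such families are closed under it, so f and
-- their counts form 27 sequences closed under m ↦ 2m + a.
-- (5) KernelRelations, Certificate: 18 integer combinations of these sequences are again closed, so
-- linear relations among them, checked at small arguments, persist after appending binary digits;
-- eleven such relations give f at 11 + r followed by any digits through f at 2, …, 10.
-- (6) LinearRepresentation: the rows of M₀, M₁ are unit rows or these relations, which makes
-- (v, M₀, M₁, w) compute f.

open import Defs

-- The Thue–Morse word: its recursive structure and the absence of cubes.
module ThueMorse where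

  open import Data.Bool using (Bool; true; false; not; _xor_)
  open import Data.Bool.Properties using (not-¬)
  open import Data.Empty using (⊥)
  open import Data.Fin using (Fin; toℕ)
  open import Data.Fin.Patterns using (0F; 1F)
  open import Data.List using (List; []; _∷_; _++_; length)
  open import Data.List.Properties using (++-assoc; ++-identityʳ)
  open import Data.Nat using (ℕ; zero; suc; _+_; _*_; _≤_; _<_; z≤n; s≤s; ⌊_/2⌋)
  open import Data.Nat.Properties
  open import Data.Product using (Σ; ∃; _,_)
  open import Relation.Binary.PropositionalEquality

  prefix : ℕ → Word
  prefix k = μ^ k (false ∷ [])

  μ-++ : ∀ u v → μ (u ++ v) ≡ μ u ++ μ v
  μ-++ []      v = refl
  μ-++ (a ∷ u) v = trans (cong (μ₁ a ++_) (μ-++ u v)) (sym (++-assoc (μ₁ a) (μ u) (μ v)))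

  length-μ : ∀ u → length (μ u) ≡ 2 * length u
  length-μ []          = refl
  length-μ (false ∷ u) = trans (cong (2 +_) (length-μ u)) (sym (*-suc 2 (length u)))
  length-μ (true  ∷ u) = trans (cong (2 +_) (length-μ u)) (sym (*-suc 2 (length u)))

  nth-μ-even : ∀ u i → nth (μ u) (2 * i) ≡ nth u i
  nth-μ-even []          i       = refl
  nth-μ-even (false ∷ u) zero    = refl
  nth-μ-even (true  ∷ u) zero    = refl
  nth-μ-even (false ∷ u) (suc i) = trans (cong (nth (μ (false ∷ u))) (*-suc 2 i)) (nth-μ-even u i)
  nth-μ-even (true  ∷ u) (suc i) = trans (cong (nth (μ (true ∷ u))) (*-suc 2 i)) (nth-μ-even u i)

  nth-μ-odd : ∀ u i → i < length u → nth (μ u) (suc (2 * i)) ≡ not (nth u i)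
  nth-μ-odd (false ∷ u) zero    _       = refl
  nth-μ-odd (true  ∷ u) zero    _       = refl
  nth-μ-odd (false ∷ u) (suc i) (s≤s p) =
    trans (cong (λ j → nth (μ (false ∷ u)) (suc j)) (*-suc 2 i)) (nth-μ-odd u i p)
  nth-μ-odd (true  ∷ u) (suc i) (s≤s p) =
    trans (cong (λ j → nth (μ (true ∷ u)) (suc j)) (*-suc 2 i)) (nth-μ-odd u i p)

  nth-++ˡ : ∀ u v i → i < length u → nth (u ++ v) i ≡ nth u i
  nth-++ˡ (a ∷ u) v zero    _       = refl
  nth-++ˡ (a ∷ u) v (suc i) (s≤s p) = nth-++ˡ u v i p

  prefix-step : ∀ k → ∃ λ r → prefix (suc k) ≡ prefix k ++ r
  prefix-step zero    = true ∷ [] , refl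
  prefix-step (suc k) with prefix-step k
  ... | r , e = μ r , trans (cong μ e) (μ-++ (prefix k) r)

  prefix-extends : ∀ j k → ∃ λ r → prefix (j + k) ≡ prefix k ++ r
  prefix-extends zero    k = [] , sym (++-identityʳ (prefix k))
  prefix-extends (suc j) k with prefix-extends j k | prefix-step (j + k)
  ... | r , e | s , e′ = r ++ s , trans e′ (trans (cong (_++ s) e) (++-assoc (prefix k) r s))

  length-prefix : ∀ k → suc k ≤ length (prefix k)
  length-prefix zero    = s≤s z≤n
  length-prefix (suc k) = begin
    2 + k                        ≤⟨ s≤s (length-prefix k) ⟩
    1 + length (prefix k)        ≤⟨ +-monoˡ-≤ (length (prefix k)) (≤-trans (s≤s z≤n) (length-prefix k)) ⟩
    length (prefix k) + length (prefix k)  ≡⟨ cong (length (prefix k) +_) (+-identityʳ (length (prefix k))) ⟨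
    2 * length (prefix k)        ≡⟨ length-μ (prefix k) ⟨
    length (prefix (suc k))      ∎
    where open ≤-Reasoning

  nth-prefix : ∀ k i → i < length (prefix k) → nth (prefix k) i ≡ t i
  nth-prefix k i i<k with prefix-extends (suc i) k | prefix-extends k (suc i)
  ... | r , e | s , e′ = begin
    nth (prefix k) i               ≡⟨ nth-++ˡ (prefix k) r i i<k ⟨
    nth (prefix k ++ r) i          ≡⟨ cong (λ w → nth w i) e ⟨
    nth (prefix (suc i + k)) i     ≡⟨ cong (λ m → nth (prefix m) i) (+-comm (suc i) k) ⟩
    nth (prefix (k + suc i)) i     ≡⟨ cong (λ w → nth w i) e′ ⟩
    nth (prefix (suc i) ++ s) i    ≡⟨ nth-++ˡ (prefix (suc i)) s i (<-trans (n<1+n i) (length-prefix (suc i))) ⟩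
    t i                            ∎
    where open ≡-Reasoning

  nth-prefix≤ : ∀ k i → i ≤ k → nth (prefix k) i ≡ t i
  nth-prefix≤ k i i≤k = nth-prefix k i (≤-<-trans i≤k (length-prefix k))

  t-even : ∀ k → t (2 * k) ≡ t k
  t-even k = trans (nth-μ-even (prefix (2 * k)) k) (nth-prefix≤ (2 * k) k (m≤m+n k _))

  t-odd : ∀ k → t (suc (2 * k)) ≡ not (t k)
  t-odd k = trans (nth-μ-odd (prefix (suc (2 * k))) k k<) (cong not (nth-prefix≤ (suc (2 * k)) k k≤))
    where
    k≤ : k ≤ suc (2 * k)
    k≤ = ≤-trans (m≤m+n k _) (n≤1+n _)
    k< : k < length (prefix (suc (2 * k)))
    k< = ≤-<-trans k≤ (length-prefix _)

  odd : ℕ → Bool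
  odd zero          = false
  odd (suc zero)    = true
  odd (suc (suc n)) = odd n

  odd-suc : ∀ n → odd (suc n) ≡ not (odd n)
  odd-suc zero          = refl
  odd-suc (suc zero)    = refl
  odd-suc (suc (suc n)) = odd-suc n

  odd-+ : ∀ m n → odd (m + n) ≡ odd m xor odd n
  odd-+ zero          n = refl
  odd-+ (suc zero)    n = odd-suc n
  odd-+ (suc (suc m)) n = odd-+ m n

  t-shift : ∀ m r → t (2 * m + r) ≡ odd r xor t (m + ⌊ r /2⌋)
  t-shift m zero          = trans (cong t (+-identityʳ (2 * m))) (trans (t-even m) (cong t (sym (+-identityʳ m))))
  t-shift m (suc zero)    = trans (cong t (+-comm (2 * m) 1)) (trans (t-odd m) (cong (λ i → not (t i)) (sym (+-identityʳ m))))
  t-shift m (suc (suc r)) = begin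
    t (2 * m + (2 + r))             ≡⟨ cong t (+-assoc (2 * m) 2 r) ⟨
    t (2 * m + 2 + r)               ≡⟨ cong (λ i → t (i + r)) (trans (+-comm (2 * m) 2) (sym (*-suc 2 m))) ⟩
    t (2 * suc m + r)               ≡⟨ t-shift (suc m) r ⟩
    odd r xor t (suc m + ⌊ r /2⌋)   ≡⟨ cong (λ i → odd r xor t i) (sym (+-suc m ⌊ r /2⌋)) ⟩
    odd r xor t (m + suc ⌊ r /2⌋)   ∎
    where open ≡-Reasoning

  lastDigit : ∀ n → Σ ℕ λ k → Σ (Fin 2) λ c → n ≡ 2 * k + toℕ c
  lastDigit zero          = 0 , 0F , refl
  lastDigit (suc zero)    = 0 , 1F , refl
  lastDigit (suc (suc n)) with lastDigit n
  ... | k , c , e = suc k , c , trans (cong (2 +_) e) (cong (_+ toℕ c) (sym (*-suc 2 k)))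

  t-pair-differs : ∀ m → t (2 * m) ≡ t (suc (2 * m)) → ⊥
  t-pair-differs m e = not-¬ refl (trans (sym (t-even m)) (trans e (t-odd m)))

  t-no-cube : ∀ k → t k ≡ t (suc k) → t (suc k) ≡ t (suc (suc k)) → ⊥
  t-no-cube k e₁ e₂ with lastDigit k
  ... | h , 0F , k≡ = t-pair-differs h (subst (λ i → t i ≡ t (suc i)) (trans k≡ (+-identityʳ _)) e₁)
  ... | h , 1F , k≡ = t-pair-differs (suc h) (subst (λ i → t i ≡ t (suc i)) sk≡ e₂)
    where
    sk≡ : suc k ≡ 2 * suc h
    sk≡ = trans (cong suc (trans k≡ (+-comm (2 * h) 1))) (sym (*-suc 2 h))

  ⌊2m+r/2⌋ : ∀ m r → ⌊ 2 * m + r /2⌋ ≡ m + ⌊ r /2⌋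
  ⌊2m+r/2⌋ zero    r = refl
  ⌊2m+r/2⌋ (suc m) r = trans (cong (λ n → ⌊ n + r /2⌋) (*-suc 2 m)) (cong suc (⌊2m+r/2⌋ m r))

  odd-2m+r : ∀ m r → odd (2 * m + r) ≡ odd r
  odd-2m+r zero    r = refl
  odd-2m+r (suc m) r = trans (cong (λ n → odd (n + r)) (*-suc 2 m)) (odd-2m+r m r)

  ⌊2m/2⌋ : ∀ m → ⌊ 2 * m /2⌋ ≡ m
  ⌊2m/2⌋ m = trans (cong ⌊_/2⌋ (sym (+-identityʳ (2 * m)))) (trans (⌊2m+r/2⌋ m 0) (+-identityʳ m))

  odd-2m : ∀ m → odd (2 * m) ≡ false
  odd-2m m = trans (cong odd (sym (+-identityʳ (2 * m)))) (odd-2m+r m 0)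

-- Counting the objects satisfying a predicate by a duplicate-free list of them.
module Cardinality where

  open import Data.Empty using (⊥)
  open import Data.List using (List; []; _∷_; _++_; length; map; filter)
  open import Data.List.Properties using (length-map; length-++)
  open import Data.List.Membership.Propositional using (_∈_)
  open import Data.List.Membership.Propositional.Properties
    using (∈-map⁺; ∈-map⁻; ∈-++⁺ˡ; ∈-++⁺ʳ; ∈-++⁻; ∈-filter⁺; ∈-filter⁻)
  open import Data.List.Relation.Unary.All using (All; []; _∷_)
  open import Data.List.Relation.Unary.AllPairs using ([]; _∷_)
  open import Data.List.Relation.Unary.Any using (here; there)
  open import Data.List.Relation.Unary.Unique.Propositional using (Unique)
  import Data.List.Relation.Unary.Unique.Propositional.Properties as Unique
  open import Data.Nat using (ℕ; _+_)
  open import Data.Product using (Σ; _×_; _,_)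
  open import Data.Sum using (_⊎_; inj₁; inj₂; [_,_])
  open import Function.Bundles using (_⇔_; mk⇔; Equivalence)
  open import Relation.Nullary using (¬_)
  open import Relation.Unary using (Decidable)
  open import Function using (_∘_)
  open import Relation.Binary.PropositionalEquality using (_≡_; refl; trans; cong₂)

  Card : {A : Set} → (A → Set) → ℕ → Set
  Card {A} P c = Σ (List A) λ xs → Unique xs × ((x : A) → (x ∈ xs) ⇔ P x) × (length xs ≡ c)

  module _ {A : Set} where

    open Equivalence

    card-cong : ∀ {P Q : A → Set} {c} → Card P c → (∀ x → P x → Q x) → (∀ x → Q x → P x) → Card Q c
    card-cong (xs , uniq , mem , len) p⇒q q⇒p =
      xs , uniq , (λ x → mk⇔ (p⇒q x ∘ to (mem x)) (from (mem x) ∘ q⇒p x)) , len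

    card-resp : ∀ {P : A → Set} {c d} → Card P c → c ≡ d → Card P d
    card-resp card refl = card

    card-⊎ : ∀ {P Q : A → Set} {a b} → Card P a → Card Q b → (∀ x → P x → Q x → ⊥) → Card (λ x → P x ⊎ Q x) (a + b)
    card-⊎ (xs , uxs , mxs , lxs) (ys , uys , mys , lys) disjoint =
      xs ++ ys ,
      Unique.++⁺ uxs uys (λ (x∈xs , x∈ys) → disjoint _ (to (mxs _) x∈xs) (to (mys _) x∈ys)) ,
      (λ x → mk⇔ ([ inj₁ ∘ to (mxs x) , inj₂ ∘ to (mys x) ] ∘ ∈-++⁻ xs)
                 [ ∈-++⁺ˡ ∘ from (mxs x) , ∈-++⁺ʳ xs ∘ from (mys x) ]) ,
      trans (length-++ xs) (cong₂ _+_ lxs lys)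

    unique-map : (g : A → A) → ∀ {xs} → Unique xs → (∀ {x y} → x ∈ xs → y ∈ xs → g x ≡ g y → x ≡ y) → Unique (map g xs)
    unique-map g {[]}     []            _   = []
    unique-map g {x ∷ xs} (x∉xs ∷ uxs) inj =
      images-differ x∉xs (λ y∈xs → inj (here refl) (there y∈xs)) ∷ unique-map g uxs (λ p q → inj (there p) (there q))
      where
      images-differ : ∀ {ys} → All (λ y → ¬ x ≡ y) ys → (∀ {y} → y ∈ ys → g x ≡ g y → x ≡ y) → All (λ z → ¬ g x ≡ z) (map g ys)
      images-differ []           _   = []
      images-differ (x≢y ∷ x≢ys) inj′ = (λ e → x≢y (inj′ (here refl) e)) ∷ images-differ x≢ys (inj′ ∘ there)

    card-image : ∀ {P Q : A → Set} {c} → Card P c → (g : A → A) →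
      (∀ x → P x → Q (g x)) → (∀ y → Q y → Σ A λ x → P x × y ≡ g x) →
      (∀ {x x′} → P x → P x′ → g x ≡ g x′ → x ≡ x′) → Card Q c
    card-image {P} {Q} (xs , uxs , mxs , lxs) g P⇒Q Q⇒P inj =
      map g xs ,
      unique-map g uxs (λ x∈ y∈ → inj (to (mxs _) x∈) (to (mxs _) y∈)) ,
      (λ y → mk⇔ (to′ y) (from′ y)) ,
      trans (length-map g xs) lxs
      where
      to′ : ∀ y → y ∈ map g xs → Q y
      to′ y y∈ with ∈-map⁻ g y∈
      ... | x , x∈ , refl = P⇒Q x (to (mxs x) x∈)
      from′ : ∀ y → Q y → y ∈ map g xs
      from′ y q with Q⇒P y q
      ... | x , px , refl = ∈-map⁺ g (from (mxs x) px)

    card-filter : ∀ {P : A → Set} (P? : Decidable P) xs → Unique xs → Card (λ x → x ∈ xs × P x) (length (filter P? xs))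
    card-filter P? xs uxs =
      filter P? xs , Unique.filter⁺ P? uxs , (λ x → mk⇔ (∈-filter⁻ P?) (λ (x∈ , px) → ∈-filter⁺ P? x∈ px)) , refl

-- Factors of t under letter constraints, and their count by repeated desubstitution.
module ConstrainedFactors where

  open ThueMorse
  open Cardinality
  open import Data.Bool using (Bool; true; false; not; _xor_; _∧_; T)
  open import Data.Bool.Properties using (T-∧; not-injective; not-involutive; xor-assoc; xor-comm; not-distribˡ-xor; xor-annihilates-not)
  import Data.Bool as Bool
  open import Data.Empty using (⊥; ⊥-elim)
  open import Data.Fin using (Fin; toℕ)
  open import Data.Fin.Patterns using (0F; 1F)
  open import Data.List using (List; []; _∷_; length; applyUpTo; map; filter)
  open import Data.List.Properties using (length-applyUpTo; ≡-dec)
  open import Data.List.Relation.Unary.All using (All; []; _∷_)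
  open import Data.List.Relation.Unary.AllPairs using ([])
  open import Data.List.Relation.Unary.Any using (here; there)
  open import Data.List.Relation.Unary.Unique.Propositional using (Unique)
  open import Data.List.Relation.Unary.Unique.DecPropositional using (unique?)
  open import Data.List.Membership.Propositional using (_∈_)
  open import Data.Nat using (ℕ; zero; suc; _+_; _*_; _≤_; _<_; z≤n; s≤s; ⌊_/2⌋; ⌈_/2⌉)
  open import Data.Nat.Properties
  open import Data.Product using (Σ; _×_; _,_; proj₁)
  open import Function.Bundles using (_⇔_; mk⇔; Equivalence)
  open import Data.Sum using (_⊎_; inj₁; inj₂)
  open import Relation.Nullary using (Dec)
  open import Relation.Nullary.Decidable using (isYes; toWitness; fromWitness; T?)
  open import Relation.Binary.PropositionalEquality
  open ≡-Reasoning

  window : ℕ → ℕ → Word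
  window i L = applyUpTo (λ j → t (i + j)) L

  nth-applyUpTo : ∀ (f : ℕ → Bool) L j → j < L → nth (applyUpTo f L) j ≡ f j
  nth-applyUpTo f (suc L) zero    _       = refl
  nth-applyUpTo f (suc L) (suc j) (s≤s p) = nth-applyUpTo (λ x → f (suc x)) L j p

  applyUpTo-cong : ∀ (f g : ℕ → Bool) L → (∀ j → j < L → f j ≡ g j) → applyUpTo f L ≡ applyUpTo g L
  applyUpTo-cong f g zero    _ = refl
  applyUpTo-cong f g (suc L) e =
    cong₂ _∷_ (e 0 (s≤s z≤n)) (applyUpTo-cong (λ x → f (suc x)) (λ x → g (suc x)) L (λ j p → e (suc j) (s≤s p)))

  nth-ext : ∀ (u v : Word) → length u ≡ length v → (∀ j → j < length u → nth u j ≡ nth v j) → u ≡ v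
  nth-ext []      []      _ _ = refl
  nth-ext (a ∷ u) (b ∷ v) e f = cong₂ _∷_ (f 0 (s≤s z≤n)) (nth-ext u v (suc-injective e) (λ j p → f (suc j) (s≤s p)))

  length-window : ∀ i L → length (window i L) ≡ L
  length-window i L = length-applyUpTo _ L

  nth-window : ∀ i L j → j < L → nth (window i L) j ≡ t (i + j)
  nth-window i L = nth-applyUpTo (λ j → t (i + j)) L

  factor-window : ∀ {u} L → length u ≡ L → Factor u → Σ ℕ λ i → u ≡ window i L
  factor-window L refl (i , e) = i , e

  window-factor : ∀ i L → Factor (window i L)
  window-factor i L = i , cong (window i) (sym (length-window i L))

  -- A constraint (i , b) asks that the letters at positions 0 and i of a word differ by b.
  Constraint : Set
  Constraint = ℕ × Bool

  holds : Word → Constraint → Bool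
  holds u (i , b) = isYes (nth u 0 xor nth u i Bool.≟ b)

  satisfies : List Constraint → Word → Bool
  satisfies []      u = true
  satisfies (c ∷ C) u = holds u c ∧ satisfies C u

  satisfies-∷ : ∀ c C u → T (satisfies (c ∷ C) u) ⇔ (T (holds u c) × T (satisfies C u))
  satisfies-∷ c C u = T-∧

  InRange : ℕ → List Constraint → Set
  InRange L C = All (λ c → proj₁ c < L) C

  Constrained : ℕ → List Constraint → Word → Set
  Constrained L C u = (length u ≡ L) × Factor u × T (satisfies C u)

  holds-window : ∀ k H i b → i < H → T (holds (window k H) (i , b)) ⇔ (t k xor t (k + i) ≡ b)
  holds-window k H i b i<H = mk⇔ (λ h → trans (sym letters) (toWitness h)) (λ e → fromWitness (trans letters e))
    where
    letters : nth (window k H) 0 xor nth (window k H) i ≡ t k xor t (k + i)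
    letters = cong₂ _xor_ (trans (nth-window k H 0 (≤-trans (s≤s z≤n) i<H)) (cong t (+-identityʳ k))) (nth-window k H i i<H)

  satisfies-window : ∀ k H C → InRange H C → T (satisfies C (window k H)) ⇔ All (λ (i , b) → t k xor t (k + i) ≡ b) C
  satisfies-window k H []            []           = mk⇔ (λ _ → []) (λ _ → _)
  satisfies-window k H ((i , b) ∷ C) (i<H ∷ C<H) = mk⇔
    (λ sat → let (h , hs) = Equivalence.to (satisfies-∷ (i , b) C (window k H)) sat
             in Equivalence.to (holds-window k H i b i<H) h ∷ Equivalence.to (satisfies-window k H C C<H) hs)
    (λ { (e ∷ es) → Equivalence.from (satisfies-∷ (i , b) C (window k H))
                      (Equivalence.from (holds-window k H i b i<H) e , Equivalence.from (satisfies-window k H C C<H) es) })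

  -- Desubstitution.  A factor of length L at position 2k+c (c a binary digit) is determined by
  -- the factor of length halfLength c L at position k, through expand c L.
  halfLength : Fin 2 → ℕ → ℕ
  halfLength c L = ⌈ toℕ c + L /2⌉

  halfLength-double : ∀ c n → halfLength c (2 * n) ≡ n + toℕ c
  halfLength-double 0F n = trans (cong ⌊_/2⌋ (+-comm 1 (2 * n))) (⌊2m+r/2⌋ n 1)
  halfLength-double 1F n = trans (cong suc (⌊2m/2⌋ n)) (+-comm 1 n)

  expand : Fin 2 → ℕ → Word → Word
  expand c L x = applyUpTo (λ j → odd (toℕ c + j) xor nth x ⌊ toℕ c + j /2⌋) L

  ⌊/2⌋<⌈/2⌉ : ∀ {m n} → m < n → ⌊ m /2⌋ < ⌈ n /2⌉
  ⌊/2⌋<⌈/2⌉ m<n = ⌊n/2⌋-mono (s≤s m<n)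

  expand-window : ∀ c L k → expand c L (window k (halfLength c L)) ≡ window (2 * k + toℕ c) L
  expand-window c L k = applyUpTo-cong _ _ L letter
    where
    letter : ∀ j → j < L → odd (toℕ c + j) xor nth (window k (halfLength c L)) ⌊ toℕ c + j /2⌋ ≡ t (2 * k + toℕ c + j)
    letter j j<L = begin
      odd (toℕ c + j) xor nth (window k (halfLength c L)) ⌊ toℕ c + j /2⌋
        ≡⟨ cong (odd (toℕ c + j) xor_) (nth-window k _ _ (⌊/2⌋<⌈/2⌉ (+-monoʳ-< (toℕ c) j<L))) ⟩
      odd (toℕ c + j) xor t (k + ⌊ toℕ c + j /2⌋)   ≡⟨ t-shift k (toℕ c + j) ⟨
      t (2 * k + (toℕ c + j))                       ≡⟨ cong t (+-assoc (2 * k) (toℕ c) j) ⟨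
      t (2 * k + toℕ c + j)                         ∎

  shrink : Fin 2 → List Constraint → List Constraint
  shrink c = map λ (i , b) → ⌊ toℕ c + i /2⌋ , odd i xor b

  xor-swap : ∀ p o q → p xor (o xor q) ≡ o xor (p xor q)
  xor-swap p o q = trans (sym (xor-assoc p o q)) (trans (cong (_xor q) (xor-comm p o)) (xor-assoc o p q))

  xor-cancel : ∀ a o p q → (a xor p) xor ((a xor o) xor q) ≡ o xor (p xor q)
  xor-cancel false o p q = xor-swap p o q
  xor-cancel true  o p q = begin
    not p xor (not o xor q)   ≡⟨ cong (not p xor_) (not-distribˡ-xor o q) ⟨
    not p xor not (o xor q)   ≡⟨ xor-annihilates-not p (o xor q) ⟩
    p xor (o xor q)           ≡⟨ xor-swap p o q ⟩
    o xor (p xor q)           ∎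

  ≟-xor : ∀ o r b → isYes (o xor r Bool.≟ b) ≡ isYes (r Bool.≟ o xor b)
  ≟-xor false r     b     = refl
  ≟-xor true  false false = refl
  ≟-xor true  false true  = refl
  ≟-xor true  true  false = refl
  ≟-xor true  true  true  = refl

  nth-expand : ∀ c L x j → j < L → nth (expand c L x) j ≡ odd (toℕ c + j) xor nth x ⌊ toℕ c + j /2⌋
  nth-expand c L x = nth-applyUpTo (λ j → odd (toℕ c + j) xor nth x ⌊ toℕ c + j /2⌋) L

  nth-expand-0 : ∀ c L x → 0 < L → nth (expand c L x) 0 ≡ odd (toℕ c) xor nth x 0
  nth-expand-0 0F L x 0<L = nth-expand 0F L x 0 0<L
  nth-expand-0 1F L x 0<L = nth-expand 1F L x 0 0<L

  holds-expand : ∀ c L x i b → 0 < L → i < L →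
    holds (expand c L x) (i , b) ≡ holds x (⌊ toℕ c + i /2⌋ , odd i xor b)
  holds-expand c L x i b 0<L i<L = begin
    isYes (nth (expand c L x) 0 xor nth (expand c L x) i Bool.≟ b)
      ≡⟨ cong (λ r → isYes (r Bool.≟ b)) (cong₂ _xor_ (nth-expand-0 c L x 0<L) (nth-expand c L x i i<L)) ⟩
    isYes ((odd (toℕ c) xor nth x 0) xor (odd (toℕ c + i) xor nth x i′) Bool.≟ b)
      ≡⟨ cong (λ o → isYes ((odd (toℕ c) xor nth x 0) xor (o xor nth x i′) Bool.≟ b)) (odd-+ (toℕ c) i) ⟩
    isYes ((odd (toℕ c) xor nth x 0) xor ((odd (toℕ c) xor odd i) xor nth x i′) Bool.≟ b)
      ≡⟨ cong (λ r → isYes (r Bool.≟ b)) (xor-cancel (odd (toℕ c)) (odd i) (nth x 0) (nth x i′)) ⟩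
    isYes (odd i xor (nth x 0 xor nth x i′) Bool.≟ b)
      ≡⟨ ≟-xor (odd i) (nth x 0 xor nth x i′) b ⟩
    isYes (nth x 0 xor nth x i′ Bool.≟ odd i xor b) ∎
    where i′ = ⌊ toℕ c + i /2⌋

  satisfies-expand : ∀ c L C x → 0 < L → InRange L C → satisfies C (expand c L x) ≡ satisfies (shrink c C) x
  satisfies-expand c L []            x 0<L []           = refl
  satisfies-expand c L ((i , b) ∷ C) x 0<L (i<L ∷ C<L) =
    cong₂ _∧_ (holds-expand c L x i b 0<L i<L) (satisfies-expand c L C x 0<L C<L)

  shrink-inRange : ∀ c L C → InRange L C → InRange (halfLength c L) (shrink c C)
  shrink-inRange c L []      []           = []
  shrink-inRange c L (_ ∷ C) (i<L ∷ C<L) = ⌊/2⌋<⌈/2⌉ (+-monoʳ-< (toℕ c) i<L) ∷ shrink-inRange c L C C<L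

  double-< : ∀ h L → h < ⌈ L /2⌉ → 2 * h < L
  double-< zero    (suc L)       _       = s≤s z≤n
  double-< (suc h) (suc zero)    (s≤s ())
  double-< (suc h) (suc (suc L)) (s≤s p) = subst (_< 2 + L) (sym (*-suc 2 h)) (s≤s (s≤s (double-< h L p)))

  double-suc-< : ∀ h L → h < ⌊ L /2⌋ → suc (2 * h) < L
  double-suc-< zero    (suc (suc L)) _       = s≤s (s≤s z≤n)
  double-suc-< (suc h) (suc (suc L)) (s≤s p) = subst (_< 2 + L) (cong suc (sym (*-suc 2 h))) (s≤s (s≤s (double-suc-< h L p)))

  -- expand c L is injective on words of length halfLength c L: every letter of x is visible in expand c L x.
  expand-injective : ∀ c L {x y} → 0 < L → length x ≡ halfLength c L → length y ≡ halfLength c L →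
    expand c L x ≡ expand c L y → x ≡ y
  expand-injective 0F L {x} {y} _ lx ly e = nth-ext x y (trans lx (sym ly)) same
    where
    visible : ∀ z h → 2 * h < L → nth (expand 0F L z) (2 * h) ≡ nth z h
    visible z h 2h<L = begin
      nth (expand 0F L z) (2 * h)           ≡⟨ nth-expand 0F L z (2 * h) 2h<L ⟩
      odd (2 * h) xor nth z ⌊ 2 * h /2⌋     ≡⟨ cong₂ (λ o i → o xor nth z i) (odd-2m h) (⌊2m/2⌋ h) ⟩
      nth z h                               ∎
    same : ∀ h → h < length x → nth x h ≡ nth y h
    same h h<x = trans (sym (visible x h 2h<L)) (trans (cong (λ w → nth w (2 * h)) e) (visible y h 2h<L))
      where
      2h<L : 2 * h < L
      2h<L = double-< h L (subst (h <_) lx h<x)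
  expand-injective 1F L {x} {y} 0<L lx ly e = nth-ext x y (trans lx (sym ly)) same
    where
    visible : ∀ z h → suc (2 * h) < L → nth (expand 1F L z) (suc (2 * h)) ≡ nth z (suc h)
    visible z h 2h+1<L = begin
      nth (expand 1F L z) (suc (2 * h))            ≡⟨ nth-expand 1F L z (suc (2 * h)) 2h+1<L ⟩
      odd (2 * h) xor nth z (suc ⌊ 2 * h /2⌋)      ≡⟨ cong₂ (λ o i → o xor nth z (suc i)) (odd-2m h) (⌊2m/2⌋ h) ⟩
      nth z (suc h)                                ∎
    same : ∀ h → h < length x → nth x h ≡ nth y h
    same zero    _     = not-injective (trans (sym (nth-expand-0 1F L x 0<L))
                           (trans (cong (λ w → nth w 0) e) (nth-expand-0 1F L y 0<L)))
    same (suc h) h<x  = trans (sym (visible x h 2h+1<L)) (trans (cong (λ w → nth w (suc (2 * h))) e) (visible y h 2h+1<L))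
      where
      2h+1<L : suc (2 * h) < L
      2h+1<L = double-suc-< h L (≤-pred (subst (suc h <_) lx h<x))

  Shifted : Fin 2 → ℕ → List Constraint → Word → Set
  Shifted c L C u = Σ Word λ x → Constrained (halfLength c L) C x × u ≡ expand c L x

  card-shifted : ∀ c L C {n} → 0 < L → Card (Constrained (halfLength c L) C) n → Card (Shifted c L C) n
  card-shifted c L C 0<L card = card-image card (expand c L) (λ x x∈ → x , x∈ , refl) (λ u u∈ → u∈)
    (λ (lx , _) (ly , _) → expand-injective c L 0<L lx ly)

  shifted⇔window : ∀ c L C {u} → Shifted c L C u ⇔ Σ ℕ λ k → (u ≡ window (2 * k + toℕ c) L) × T (satisfies C (window k (halfLength c L)))
  shifted⇔window c L C = mk⇔ to from
    where
    to : ∀ {u} → Shifted c L C u → Σ ℕ λ k → (u ≡ window (2 * k + toℕ c) L) × T (satisfies C (window k (halfLength c L)))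
    to (x , (lx , fx , sx) , refl) with factor-window _ lx fx
    ... | k , refl = k , expand-window c L k , sx
    from : ∀ {u} → (Σ ℕ λ k → (u ≡ window (2 * k + toℕ c) L) × T (satisfies C (window k (halfLength c L)))) → Shifted c L C u
    from (k , refl , sat) = window k H , (length-window k H , window-factor k H , sat) , sym (expand-window c L k)
      where
      H : ℕ
      H = halfLength c L

  constrained→shifted : ∀ L C {u} → 0 < L → InRange L C → Constrained L C u → Σ (Fin 2) λ c → Shifted c L (shrink c C) u
  constrained→shifted L C 0<L C<L (len , fac , sat) with factor-window L len fac
  ... | i , refl with lastDigit i
  ... | k , c , refl = c , window k H , (length-window k H , window-factor k H , sat′) , sym (expand-window c L k)
    where
    H : ℕ
    H = halfLength c L
    sat′ : T (satisfies (shrink c C) (window k H))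
    sat′ = subst T (trans (sym (cong (satisfies C) (expand-window c L k))) (satisfies-expand c L C (window k H) 0<L C<L)) sat

  shifted→constrained : ∀ c L C {u} → 0 < L → InRange L C → Shifted c L (shrink c C) u → Constrained L C u
  shifted→constrained c L C 0<L C<L (x , (lx , fx , sx) , refl) with factor-window _ lx fx
  ... | k , refl =
    length-applyUpTo _ L ,
    subst Factor (sym (expand-window c L k)) (window-factor (2 * k + toℕ c) L) ,
    subst T (sym (satisfies-expand c L C (window k _) 0<L C<L)) sx

  window-no-cube : ∀ k M → 3 ≤ M → nth (window k M) 0 ≡ nth (window k M) 1 → nth (window k M) 1 ≡ nth (window k M) 2 → ⊥
  window-no-cube k M 3≤M e₁ e₂ = t-no-cube k e₁′ e₂′
    where
    at : ∀ j → j < M → nth (window k M) j ≡ t (j + k)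
    at j j<M = trans (nth-window k M j j<M) (cong t (+-comm k j))
    e₁′ : t (0 + k) ≡ t (1 + k)
    e₁′ = trans (sym (at 0 (≤-trans (s≤s z≤n) 3≤M))) (trans e₁ (at 1 (≤-trans (s≤s (s≤s z≤n)) 3≤M)))
    e₂′ : t (1 + k) ≡ t (2 + k)
    e₂′ = trans (sym (at 1 (≤-trans (s≤s (s≤s z≤n)) 3≤M))) (trans e₂ (at 2 3≤M))

  expand-overlap : ∀ L x y → 4 ≤ L → expand 0F L x ≡ expand 1F L y → (nth y 0 ≡ nth y 1) × (nth y 1 ≡ nth y 2)
  expand-overlap .(4 + L) x y (s≤s (s≤s (s≤s (s≤s {n = L} _)))) e =
    trans (sym (not-involutive (nth y 0))) (trans (cong not (sym (letter 0))) (letter 1)) ,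
    trans (sym (not-involutive (nth y 1))) (trans (cong not (sym (letter 2))) (letter 3))
    where
    letter : ∀ j → nth (expand 0F (4 + L) x) j ≡ nth (expand 1F (4 + L) y) j
    letter j = cong (λ w → nth w j) e

  shifted-disjoint : ∀ L C C′ {u} → 4 ≤ L → Shifted 0F L C u → Shifted 1F L C′ u → ⊥
  shifted-disjoint L C C′ 4≤L (x , _ , refl) (y , (ly , fy , _) , e) with factor-window _ ly fy
  ... | k , refl with expand-overlap L x (window k (halfLength 1F L)) 4≤L e
  ... | e₁ , e₂ = window-no-cube k (halfLength 1F L) (s≤s (⌊n/2⌋-mono 4≤L)) e₁ e₂

  card-constrained-split : ∀ L C {a b} → 4 ≤ L → InRange L C →
    Card (Constrained (halfLength 0F L) (shrink 0F C)) a →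
    Card (Constrained (halfLength 1F L) (shrink 1F C)) b →
    Card (Constrained L C) (a + b)
  card-constrained-split L C 4≤L C<L card₀ card₁ =
    card-cong (card-⊎ (card-shifted 0F L (shrink 0F C) 0<L card₀) (card-shifted 1F L (shrink 1F C) 0<L card₁)
                      (λ _ → shifted-disjoint L (shrink 0F C) (shrink 1F C) 4≤L))
      (λ _ → λ { (inj₁ s) → shifted→constrained 0F L C 0<L C<L s ; (inj₂ s) → shifted→constrained 1F L C 0<L C<L s })
      (λ _ u∈ → by-digit (constrained→shifted L C 0<L C<L u∈))
    where
    0<L : 0 < L
    0<L = ≤-trans (s≤s z≤n) 4≤L
    by-digit : ∀ {u} → Σ (Fin 2) (λ c → Shifted c L (shrink c C) u) →
      Shifted 0F L (shrink 0F C) u ⊎ Shifted 1F L (shrink 1F C) u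
    by-digit (0F , s) = inj₁ s
    by-digit (1F , s) = inj₂ s

  shortFactors : ℕ → List Word
  shortFactors 0 = [] ∷ []
  shortFactors 1 = (false ∷ []) ∷ (true ∷ []) ∷ []
  shortFactors 2 = (false ∷ false ∷ []) ∷ (false ∷ true ∷ []) ∷ (true ∷ false ∷ []) ∷ (true ∷ true ∷ []) ∷ []
  shortFactors 3 = (false ∷ false ∷ true ∷ []) ∷ (false ∷ true ∷ false ∷ []) ∷ (false ∷ true ∷ true ∷ []) ∷
                   (true ∷ false ∷ false ∷ []) ∷ (true ∷ false ∷ true ∷ []) ∷ (true ∷ true ∷ false ∷ []) ∷ []
  shortFactors _ = []

  shortFactors-unique : ∀ L → Unique (shortFactors L)
  shortFactors-unique 0 = toWitness {a? = unique? (≡-dec Bool._≟_) (shortFactors 0)} _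
  shortFactors-unique 1 = toWitness {a? = unique? (≡-dec Bool._≟_) (shortFactors 1)} _
  shortFactors-unique 2 = toWitness {a? = unique? (≡-dec Bool._≟_) (shortFactors 2)} _
  shortFactors-unique 3 = toWitness {a? = unique? (≡-dec Bool._≟_) (shortFactors 3)} _
  shortFactors-unique (suc (suc (suc (suc _)))) = []

  shortFactors-sound : ∀ L {u} → u ∈ shortFactors L → (length u ≡ L) × Factor u
  shortFactors-sound 0 (here refl)                                         = refl , 0 , refl
  shortFactors-sound 1 (here refl)                                         = refl , 0 , refl
  shortFactors-sound 1 (there (here refl))                                 = refl , 1 , refl
  shortFactors-sound 2 (here refl)                                         = refl , 5 , refl
  shortFactors-sound 2 (there (here refl))                                 = refl , 0 , refl
  shortFactors-sound 2 (there (there (here refl)))                         = refl , 2 , refl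
  shortFactors-sound 2 (there (there (there (here refl))))                 = refl , 1 , refl
  shortFactors-sound 3 (here refl)                                         = refl , 5 , refl
  shortFactors-sound 3 (there (here refl))                                 = refl , 3 , refl
  shortFactors-sound 3 (there (there (here refl)))                         = refl , 0 , refl
  shortFactors-sound 3 (there (there (there (here refl))))                 = refl , 4 , refl
  shortFactors-sound 3 (there (there (there (there (here refl)))))         = refl , 11 , refl
  shortFactors-sound 3 (there (there (there (there (there (here refl)))))) = refl , 1 , refl

  cube-free-triple : ∀ a b c → (a ≡ b → b ≡ c → ⊥) → (a ∷ b ∷ c ∷ []) ∈ shortFactors 3
  cube-free-triple false false false nc = ⊥-elim (nc refl refl)
  cube-free-triple false false true  _  = here refl
  cube-free-triple false true  false _  = there (here refl)
  cube-free-triple false true  true  _  = there (there (here refl))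
  cube-free-triple true  false false _  = there (there (there (here refl)))
  cube-free-triple true  false true  _  = there (there (there (there (here refl))))
  cube-free-triple true  true  false _  = there (there (there (there (there (here refl)))))
  cube-free-triple true  true  true  nc = ⊥-elim (nc refl refl)

  shortFactors-complete : ∀ L {u} → L < 4 → length u ≡ L → Factor u → u ∈ shortFactors L
  shortFactors-complete 0 {[]}                  _ _ _ = here refl
  shortFactors-complete 1 {false ∷ []}          _ _ _ = here refl
  shortFactors-complete 1 {true ∷ []}           _ _ _ = there (here refl)
  shortFactors-complete 2 {false ∷ false ∷ []}  _ _ _ = here refl
  shortFactors-complete 2 {false ∷ true ∷ []}   _ _ _ = there (here refl)
  shortFactors-complete 2 {true ∷ false ∷ []}   _ _ _ = there (there (here refl))
  shortFactors-complete 2 {true ∷ true ∷ []}    _ _ _ = there (there (there (here refl)))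
  shortFactors-complete 3 _ len fac with factor-window 3 len fac
  ... | i , refl = cube-free-triple _ _ _ (window-no-cube i 3 ≤-refl)
  shortFactors-complete (suc (suc (suc (suc L)))) (s≤s (s≤s (s≤s (s≤s ())))) _ _

  satisfies? : ∀ C u → Dec (T (satisfies C u))
  satisfies? C u = T? (satisfies C u)

  card-short : ∀ L C → L < 4 → Card (Constrained L C) (length (filter (satisfies? C) (shortFactors L)))
  card-short L C L<4 = card-cong (card-filter (satisfies? C) (shortFactors L) (shortFactors-unique L))
    (λ u (u∈ , sat) → let (len , fac) = shortFactors-sound L u∈ in len , fac , sat)
    (λ u (len , fac , sat) → shortFactors-complete L L<4 len fac , sat)

  shortCount : ℕ → List Constraint → ℕ
  shortCount L C = length (filter (satisfies? C) (shortFactors L))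

  -- countWithin f L C is computed with fuel f > L (the length shrinks at each split).
  countWithin : ℕ → ℕ → List Constraint → ℕ
  countWithin zero    _ _ = 0
  countWithin (suc f) 0 C = shortCount 0 C
  countWithin (suc f) 1 C = shortCount 1 C
  countWithin (suc f) 2 C = shortCount 2 C
  countWithin (suc f) 3 C = shortCount 3 C
  countWithin (suc f) L@(suc (suc (suc (suc _)))) C =
    countWithin f (halfLength 0F L) (shrink 0F C) + countWithin f (halfLength 1F L) (shrink 1F C)

  halfLength< : ∀ c L → halfLength c (4 + L) < 4 + L
  halfLength< 0F L = s≤s (s≤s (s≤s (⌊n/2⌋≤n (suc L))))
  halfLength< 1F L = s≤s (s≤s (s≤s (s≤s (⌊n/2⌋≤n L))))

  card-countWithin : ∀ f L C → L < f → InRange L C → Card (Constrained L C) (countWithin f L C)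
  card-countWithin (suc f) 0 C _ _ = card-short 0 C (s≤s z≤n)
  card-countWithin (suc f) 1 C _ _ = card-short 1 C (s≤s (s≤s z≤n))
  card-countWithin (suc f) 2 C _ _ = card-short 2 C (s≤s (s≤s (s≤s z≤n)))
  card-countWithin (suc f) 3 C _ _ = card-short 3 C (s≤s (s≤s (s≤s (s≤s z≤n))))
  card-countWithin (suc f) L@(suc (suc (suc (suc L′)))) C (s≤s L≤f) C<L =
    card-constrained-split L C (s≤s (s≤s (s≤s (s≤s z≤n)))) C<L (half 0F) (half 1F)
    where
    half : ∀ c → Card (Constrained (halfLength c L) (shrink c C)) (countWithin f (halfLength c L) (shrink c C))
    half c = card-countWithin f (halfLength c L) (shrink c C) (<-≤-trans (halfLength< c L′) L≤f) (shrink-inRange c L C C<L)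

  countWithin-stable : ∀ f f′ L C → L < f → L < f′ → countWithin f L C ≡ countWithin f′ L C
  countWithin-stable (suc f) (suc f′) 0 C _ _ = refl
  countWithin-stable (suc f) (suc f′) 1 C _ _ = refl
  countWithin-stable (suc f) (suc f′) 2 C _ _ = refl
  countWithin-stable (suc f) (suc f′) 3 C _ _ = refl
  countWithin-stable (suc f) (suc f′) L@(suc (suc (suc (suc L′)))) C (s≤s L≤f) (s≤s L≤f′) = cong₂ _+_ (half 0F) (half 1F)
    where
    half : ∀ c → countWithin f (halfLength c L) (shrink c C) ≡ countWithin f′ (halfLength c L) (shrink c C)
    half c = countWithin-stable f f′ _ _ (<-≤-trans (halfLength< c L′) L≤f) (<-≤-trans (halfLength< c L′) L≤f′)

  count : ℕ → List Constraint → ℕ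
  count L C = countWithin (suc L) L C

  card-count : ∀ L C → InRange L C → Card (Constrained L C) (count L C)
  card-count L C = card-countWithin (suc L) L C ≤-refl

  count-split : ∀ L C → 4 ≤ L → count L C ≡ count (halfLength 0F L) (shrink 0F C) + count (halfLength 1F L) (shrink 1F C)
  count-split .(4 + L′) C (s≤s (s≤s (s≤s (s≤s {n = L′} _)))) = cong₂ _+_ (half 0F) (half 1F)
    where
    half : ∀ c → countWithin (4 + L′) (halfLength c (4 + L′)) (shrink c C) ≡ count (halfLength c (4 + L′)) (shrink c C)
    half c = countWithin-stable _ _ _ _ (halfLength< c L′) ≤-refl

-- Abelian squares among the factors of t, and their counts as constrained counts.
module AbelianSquares where

  open ThueMorse
  open Cardinality
  open ConstrainedFactors
  open import Data.Bool using (Bool; true; false; not; _xor_)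
  open import Data.Bool.Properties using (not-¬)
  open import Data.Empty using (⊥; ⊥-elim)
  open import Data.Fin.Patterns using (0F; 1F)
  open import Data.List using (List; []; _∷_; _++_; length; applyUpTo)
  open import Data.List.Properties using (length-++; ∷-injective)
  open import Data.List.Relation.Unary.All using ([]; _∷_)
  open import Data.Nat using (ℕ; zero; suc; _+_; _*_; _≤_; _<_; z≤n; s≤s)
  open import Data.Nat.Properties
  open import Data.Nat.Tactic.RingSolver using (solve-∀)
  open import Data.Product using (Σ; _×_; _,_; proj₁; proj₂)
  open import Data.Sum using (_⊎_; inj₁; inj₂)
  open import Function.Bundles using (_⇔_; mk⇔; Equivalence)
  open import Relation.Binary.PropositionalEquality
  open ≡-Reasoning

  applyUpTo-++ : ∀ (f : ℕ → Bool) m l → applyUpTo f (m + l) ≡ applyUpTo f m ++ applyUpTo (λ j → f (m + j)) l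
  applyUpTo-++ f zero    l = refl
  applyUpTo-++ f (suc m) l = cong (f 0 ∷_) (applyUpTo-++ (λ j → f (suc j)) m l)

  window-++ : ∀ i m l → window i (m + l) ≡ window i m ++ window (i + m) l
  window-++ i m l = trans (applyUpTo-++ (λ j → t (i + j)) m l)
    (cong (window i m ++_) (applyUpTo-cong _ _ l (λ j _ → cong t (sym (+-assoc i m j)))))

  occ-++ : ∀ a x y → occ a (x ++ y) ≡ occ a x + occ a y
  occ-++ a     []          y = refl
  occ-++ false (false ∷ x) y = cong suc (occ-++ false x y)
  occ-++ false (true  ∷ x) y = occ-++ false x y
  occ-++ true  (false ∷ x) y = occ-++ true x y
  occ-++ true  (true  ∷ x) y = cong suc (occ-++ true x y)

  length-occ : ∀ x → length x ≡ occ true x + occ false x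
  length-occ []          = refl
  length-occ (false ∷ x) = trans (cong suc (length-occ x)) (sym (+-suc _ _))
  length-occ (true  ∷ x) = cong suc (length-occ x)

  ++-split : ∀ (x x′ y y′ : Word) → length x ≡ length x′ → x ++ y ≡ x′ ++ y′ → (x ≡ x′) × (y ≡ y′)
  ++-split []      []       y y′ _ e = refl , e
  ++-split (a ∷ x) (b ∷ x′) y y′ l e with ∷-injective e
  ... | a≡b , e′ with ++-split x x′ y y′ (suc-injective l) e′
  ... | x≡x′ , y≡y′ = cong₂ _∷_ a≡b x≡x′ , y≡y′

  half-injective : ∀ a b → a + a ≡ b + b → a ≡ b
  half-injective zero    zero    _ = refl
  half-injective (suc a) (suc b) e =
    cong suc (half-injective a b (suc-injective (trans (sym (+-suc a a)) (trans (suc-injective e) (+-suc b b)))))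

  weight : ℕ → ℕ → ℕ
  weight i l = occ true (window i l)

  Balanced : ℕ → ℕ → Set
  Balanced i n = weight i n ≡ weight (i + n) n

  abelian⇔balanced : ∀ i n → AbelianSquare (window i (2 * n)) ⇔ Balanced i n
  abelian⇔balanced i n = mk⇔ to from
    where
    halves : window i (2 * n) ≡ window i n ++ window (i + n) n
    halves = trans (cong (window i) (cong (n +_) (+-identityʳ n))) (window-++ i n n)
    to : AbelianSquare (window i (2 * n)) → Balanced i n
    to (x , y , e , same) = trans (cong (occ true) (sym x≡)) (trans (same true) (cong (occ true) y≡))
      where
      |x|≡|y| : length x ≡ length y
      |x|≡|y| = trans (length-occ x) (trans (cong₂ _+_ (same true) (same false)) (sym (length-occ y)))
      e′ : x ++ y ≡ window i n ++ window (i + n) n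
      e′ = trans (sym e) halves
      |x|≡n : length x ≡ n
      |x|≡n = half-injective _ _ (begin
        length x + length x   ≡⟨ cong (length x +_) |x|≡|y| ⟩
        length x + length y   ≡⟨ length-++ x ⟨
        length (x ++ y)       ≡⟨ cong length e′ ⟩
        length (window i n ++ window (i + n) n) ≡⟨ length-++ (window i n) ⟩
        length (window i n) + length (window (i + n) n) ≡⟨ cong₂ _+_ (length-window i n) (length-window (i + n) n) ⟩
        n + n                 ∎)
      x≡ : x ≡ window i n
      x≡ = proj₁ (++-split x (window i n) y _ (trans |x|≡n (sym (length-window i n))) e′)
      y≡ : y ≡ window (i + n) n
      y≡ = proj₂ (++-split x (window i n) y _ (trans |x|≡n (sym (length-window i n))) e′)
    from : Balanced i n → AbelianSquare (window i (2 * n))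
    from eq = window i n , window (i + n) n , halves , same
      where
      same : ∀ a → occ a (window i n) ≡ occ a (window (i + n) n)
      same true  = eq
      same false = +-cancelˡ-≡ (weight i n) _ _ (begin
        weight i n + occ false (window i n)  ≡⟨ length-occ (window i n) ⟨
        length (window i n)                  ≡⟨ trans (length-window i n) (sym (length-window (i + n) n)) ⟩
        length (window (i + n) n)            ≡⟨ length-occ (window (i + n) n) ⟩
        weight (i + n) n + occ false (window (i + n) n) ≡⟨ cong (_+ occ false (window (i + n) n)) eq ⟨
        weight i n + occ false (window (i + n) n) ∎)

  bit : Bool → ℕ
  bit b = occ true (b ∷ [])

  bit-not : ∀ b → bit b + bit (not b) ≡ 1
  bit-not false = refl
  bit-not true  = refl

  bit-injective : ∀ {a b} → bit a ≡ bit b → a ≡ b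
  bit-injective {false} {false} _ = refl
  bit-injective {true}  {true}  _ = refl

  weight-+ : ∀ i m l → weight i (m + l) ≡ weight i m + weight (i + m) l
  weight-+ i m l = trans (cong (occ true) (window-++ i m l)) (occ-++ true (window i m) (window (i + m) l))

  weight-1 : ∀ i → weight i 1 ≡ bit (t i)
  weight-1 i = cong (λ j → bit (t j)) (+-identityʳ i)

  weight-block : ∀ k → weight (2 * k) 2 ≡ 1
  weight-block k = begin
    weight (2 * k) 2                              ≡⟨ weight-+ (2 * k) 1 1 ⟩
    weight (2 * k) 1 + weight (2 * k + 1) 1       ≡⟨ cong₂ _+_ (weight-1 (2 * k)) (weight-1 (2 * k + 1)) ⟩
    bit (t (2 * k)) + bit (t (2 * k + 1))         ≡⟨ cong₂ (λ a b → bit a + bit b) (t-even k) (trans (cong t (+-comm (2 * k) 1)) (t-odd k)) ⟩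
    bit (t k) + bit (not (t k))                   ≡⟨ bit-not (t k) ⟩
    1                                             ∎

  weight-even : ∀ k m → weight (2 * k) (2 * m) ≡ m
  weight-even k zero    = refl
  weight-even k (suc m) = begin
    weight (2 * k) (2 * suc m)                    ≡⟨ cong (weight (2 * k)) (*-suc 2 m) ⟩
    weight (2 * k) (2 + 2 * m)                    ≡⟨ weight-+ (2 * k) 2 (2 * m) ⟩
    weight (2 * k) 2 + weight (2 * k + 2) (2 * m) ≡⟨ cong₂ _+_ (weight-block k) (cong (λ i → weight i (2 * m)) (2k+2 k)) ⟩
    1 + weight (2 * suc k) (2 * m)                ≡⟨ cong suc (weight-even (suc k) m) ⟩
    suc m                                         ∎
    where
    2k+2 : ∀ k → 2 * k + 2 ≡ 2 * suc k
    2k+2 = solve-∀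

  weight-even-odd : ∀ k m → weight (2 * k) (suc (2 * m)) ≡ m + bit (t (k + m))
  weight-even-odd k m = begin
    weight (2 * k) (suc (2 * m))                  ≡⟨ cong (weight (2 * k)) (+-comm 1 (2 * m)) ⟩
    weight (2 * k) (2 * m + 1)                    ≡⟨ weight-+ (2 * k) (2 * m) 1 ⟩
    weight (2 * k) (2 * m) + weight (2 * k + 2 * m) 1   ≡⟨ cong₂ _+_ (weight-even k m) (weight-1 (2 * k + 2 * m)) ⟩
    m + bit (t (2 * k + 2 * m))                   ≡⟨ cong (λ i → m + bit (t i)) (*-distribˡ-+ 2 k m) ⟨
    m + bit (t (2 * (k + m)))                     ≡⟨ cong (λ b → m + bit b) (t-even (k + m)) ⟩
    m + bit (t (k + m))                           ∎

  weight-odd-start : ∀ k l → weight (suc (2 * k)) (suc l) ≡ bit (not (t k)) + weight (2 * suc k) l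
  weight-odd-start k l = begin
    weight (suc (2 * k)) (1 + l)                  ≡⟨ weight-+ (suc (2 * k)) 1 l ⟩
    weight (suc (2 * k)) 1 + weight (suc (2 * k) + 1) l ≡⟨ cong₂ _+_ (trans (weight-1 (suc (2 * k))) (cong bit (t-odd k))) (cong (λ i → weight i l) (2k+1+1 k)) ⟩
    bit (not (t k)) + weight (2 * suc k) l        ∎
    where
    2k+1+1 : ∀ k → suc (2 * k) + 1 ≡ 2 * suc k
    2k+1+1 = solve-∀

  -- c = 0, n = 2s: always an abelian square (both halves consist of s blocks).
  balanced-even-even : ∀ k s → Balanced (2 * k) (2 * s)
  balanced-even-even k s = begin
    weight (2 * k) (2 * s)                ≡⟨ weight-even k s ⟩
    s                                     ≡⟨ weight-even (k + s) s ⟨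
    weight (2 * (k + s)) (2 * s)          ≡⟨ cong (λ i → weight i (2 * s)) (*-distribˡ-+ 2 k s) ⟩
    weight (2 * k + 2 * s) (2 * s)        ∎

  -- c = 0, n = 2s+1: never (the halves split the block μ(t(k+s)) between them).
  unbalanced-even-odd : ∀ k s → Balanced (2 * k) (suc (2 * s)) → ⊥
  unbalanced-even-odd k s eq = not-¬ refl (bit-injective (+-cancelˡ-≡ s _ _ (begin
    s + bit (t (k + s))                                ≡⟨ weight-even-odd k s ⟨
    weight (2 * k) (suc (2 * s))                       ≡⟨ eq ⟩
    weight (2 * k + suc (2 * s)) (suc (2 * s))         ≡⟨ cong (λ i → weight i (suc (2 * s))) (2k+2s+1 k s) ⟩
    weight (suc (2 * (k + s))) (suc (2 * s))           ≡⟨ weight-odd-start (k + s) (2 * s) ⟩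
    bit (not (t (k + s))) + weight (2 * suc (k + s)) (2 * s) ≡⟨ cong (bit (not (t (k + s))) +_) (weight-even (suc (k + s)) s) ⟩
    bit (not (t (k + s))) + s                          ≡⟨ +-comm _ s ⟩
    s + bit (not (t (k + s)))                          ∎)))
    where
    2k+2s+1 : ∀ k s → 2 * k + suc (2 * s) ≡ suc (2 * (k + s))
    2k+2s+1 = solve-∀

  balanced-odd-odd : ∀ k s → Balanced (suc (2 * k)) (suc (2 * s)) ⇔ (not (t k) ≡ t (k + suc (2 * s)))
  balanced-odd-odd k s = mk⇔
    (λ eq → bit-injective (+-cancelʳ-≡ s _ _ (trans (sym left) (trans eq (trans right (+-comm s _))))))
    (λ e → trans left (trans (cong (λ b → bit b + s) e) (trans (+-comm _ s) (sym right))))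
    where
    left : weight (suc (2 * k)) (suc (2 * s)) ≡ bit (not (t k)) + s
    left = trans (weight-odd-start k (2 * s)) (cong (bit (not (t k)) +_) (weight-even (suc k) s))
    right : weight (suc (2 * k) + suc (2 * s)) (suc (2 * s)) ≡ s + bit (t (k + suc (2 * s)))
    right = begin
      weight (suc (2 * k) + suc (2 * s)) (suc (2 * s))   ≡⟨ cong (λ i → weight i (suc (2 * s))) (arith₁ k s) ⟩
      weight (2 * (k + suc s)) (suc (2 * s))             ≡⟨ weight-even-odd (k + suc s) s ⟩
      s + bit (t (k + suc s + s))                        ≡⟨ cong (λ i → s + bit (t i)) (arith₂ k s) ⟩
      s + bit (t (k + suc (2 * s)))                      ∎
      where
      arith₁ : ∀ k s → suc (2 * k) + suc (2 * s) ≡ 2 * (k + suc s)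
      arith₁ = solve-∀
      arith₂ : ∀ k s → k + suc s + s ≡ k + suc (2 * s)
      arith₂ = solve-∀

  bits-balance : ∀ a b c → (bit (not a) + bit b ≡ bit (not b) + bit c) ⇔ ((a ≡ b) × (b ≡ c))
  bits-balance a b c = mk⇔ (to a b c) from
    where
    from : (a ≡ b) × (b ≡ c) → bit (not a) + bit b ≡ bit (not b) + bit c
    from (refl , refl) = refl
    to : ∀ a b c → bit (not a) + bit b ≡ bit (not b) + bit c → (a ≡ b) × (b ≡ c)
    to false false false _ = refl , refl
    to true  true  true  _ = refl , refl
    to false false true  ()
    to false true  false ()
    to false true  true  ()
    to true  false false ()
    to true  false true  ()
    to true  true  false ()

  balanced-odd-even : ∀ k r → let s = suc r in
    Balanced (suc (2 * k)) (2 * s) ⇔ ((t k ≡ t (k + s)) × (t (k + s) ≡ t (k + 2 * s)))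
  balanced-odd-even k r = mk⇔
    (λ eq → Equivalence.to (bits-balance (t k) (t (k + s)) (t (k + 2 * s))) (+-cancelˡ-≡ r _ _ (trans (sym left) (trans eq right))))
    (λ e → trans left (trans (cong (r +_) (Equivalence.from (bits-balance (t k) (t (k + s)) (t (k + 2 * s))) e)) (sym right)))
    where
    s : ℕ
    s = suc r
    swap : ∀ x r y → x + (r + y) ≡ r + (x + y)
    swap = solve-∀
    left : weight (suc (2 * k)) (2 * s) ≡ r + (bit (not (t k)) + bit (t (k + s)))
    left = begin
      weight (suc (2 * k)) (2 * s)                       ≡⟨ cong (weight (suc (2 * k))) (*-suc 2 r) ⟩
      weight (suc (2 * k)) (suc (suc (2 * r)))           ≡⟨ weight-odd-start k (suc (2 * r)) ⟩
      bit (not (t k)) + weight (2 * suc k) (suc (2 * r)) ≡⟨ cong (bit (not (t k)) +_) (weight-even-odd (suc k) r) ⟩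
      bit (not (t k)) + (r + bit (t (suc k + r)))        ≡⟨ cong (λ i → bit (not (t k)) + (r + bit (t i))) (sym (+-suc k r)) ⟩
      bit (not (t k)) + (r + bit (t (k + s)))            ≡⟨ swap (bit (not (t k))) r (bit (t (k + s))) ⟩
      r + (bit (not (t k)) + bit (t (k + s)))            ∎
    right : weight (suc (2 * k) + 2 * s) (2 * s) ≡ r + (bit (not (t (k + s))) + bit (t (k + 2 * s)))
    right = begin
      weight (suc (2 * k) + 2 * s) (2 * s)               ≡⟨ cong₂ weight (arith₁ k r) (*-suc 2 r) ⟩
      weight (suc (2 * (k + s))) (suc (suc (2 * r)))     ≡⟨ weight-odd-start (k + s) (suc (2 * r)) ⟩
      bit (not (t (k + s))) + weight (2 * suc (k + s)) (suc (2 * r)) ≡⟨ cong (bit (not (t (k + s))) +_) (weight-even-odd (suc (k + s)) r) ⟩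
      bit (not (t (k + s))) + (r + bit (t (suc (k + s) + r)))         ≡⟨ cong (λ i → bit (not (t (k + s))) + (r + bit (t i))) (arith₂ k r) ⟩
      bit (not (t (k + s))) + (r + bit (t (k + 2 * s)))  ≡⟨ swap (bit (not (t (k + s)))) r (bit (t (k + 2 * s))) ⟩
      r + (bit (not (t (k + s))) + bit (t (k + 2 * s)))  ∎
      where
      arith₁ : ∀ k r → suc (2 * k) + 2 * suc r ≡ suc (2 * (k + suc r))
      arith₁ = solve-∀
      arith₂ : ∀ k r → suc (k + suc r) + r ≡ k + 2 * suc r
      arith₂ = solve-∀

  counted⇔window : ∀ n {u} → Counted n u ⇔ Σ ℕ λ i → (u ≡ window i (2 * n)) × Balanced i n
  counted⇔window n = mk⇔ to from
    where
    to : ∀ {u} → Counted n u → Σ ℕ λ i → (u ≡ window i (2 * n)) × Balanced i n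
    to (len , fac , sq) with factor-window (2 * n) len fac
    ... | i , refl = i , refl , Equivalence.to (abelian⇔balanced i n) sq
    from : ∀ {u} → (Σ ℕ λ i → (u ≡ window i (2 * n)) × Balanced i n) → Counted n u
    from (i , refl , eq) = length-window i (2 * n) , window-factor i (2 * n) , Equivalence.from (abelian⇔balanced i n) eq

  xor≡false : ∀ {a b} → a xor b ≡ false → a ≡ b
  xor≡false {false} {false} _ = refl
  xor≡false {true}  {true}  _ = refl

  ≡⇒xor≡false : ∀ {a b} → a ≡ b → a xor b ≡ false
  ≡⇒xor≡false {false} refl = refl
  ≡⇒xor≡false {true}  refl = refl

  xor≡true : ∀ {a b} → a xor b ≡ true → not a ≡ b
  xor≡true {false} {true}  _ = refl
  xor≡true {true}  {false} _ = refl

  not≡⇒xor≡true : ∀ {a b} → not a ≡ b → a xor b ≡ true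
  not≡⇒xor≡true {false} refl = refl
  not≡⇒xor≡true {true}  refl = refl

  -- Abelian squares of odd half-length n = 2m+1 sit at odd positions 2k+1 with t(k+n) = ¬ t(k).
  card-counted-odd : ∀ m → let n = suc (2 * m) in Card (Counted n) (count (n + 1) ((n , true) ∷ []))
  card-counted-odd m = card-resp (card-cong (card-shifted 1F L Cn (s≤s z≤n) (card-count H Cn Cn<H)) shifted→counted counted→shifted)
                                 (cong (λ h → count h Cn) (halfLength-double 1F n))
    where
    n L H : ℕ
    n = suc (2 * m)
    L = 2 * n
    H = halfLength 1F L
    Cn : List Constraint
    Cn = (n , true) ∷ []
    Cn<H : InRange H Cn
    Cn<H = subst (n <_) (sym (halfLength-double 1F n)) (m<m+n n (s≤s z≤n)) ∷ []
    counted→shifted : ∀ u → Counted n u → Shifted 1F L Cn u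
    counted→shifted u cu with Equivalence.to (counted⇔window n) cu
    ... | i , u≡ , bal with lastDigit i
    ... | k , 0F , refl = ⊥-elim (unbalanced-even-odd k m (subst (λ j → Balanced j n) (+-identityʳ (2 * k)) bal))
    ... | k , 1F , refl = Equivalence.from (shifted⇔window 1F L Cn) (k , u≡ , Equivalence.from (satisfies-window k H Cn Cn<H) (e ∷ []))
      where
      e : t k xor t (k + n) ≡ true
      e = not≡⇒xor≡true (Equivalence.to (balanced-odd-odd k m) (subst (λ j → Balanced j n) (+-comm (2 * k) 1) bal))
    shifted→counted : ∀ u → Shifted 1F L Cn u → Counted n u
    shifted→counted u su with Equivalence.to (shifted⇔window 1F L Cn) su
    ... | k , u≡ , sat with Equivalence.to (satisfies-window k H Cn Cn<H) sat
    ... | e ∷ [] = Equivalence.from (counted⇔window n) (2 * k + 1 , u≡ , subst (λ j → Balanced j n) (+-comm 1 (2 * k)) bal)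
      where
      bal : Balanced (suc (2 * k)) n
      bal = Equivalence.from (balanced-odd-odd k m) (xor≡true e)

  -- Abelian squares of even half-length n = 2s (s ≥ 1): all factors at even positions, together with
  -- those at odd positions 2k+1 with t(k) = t(k+s) = t(k+2s).
  card-counted-even : ∀ r → let s = suc r ; n = 2 * s in
    Card (Counted n) (count (n + 0) [] + count (n + 1) ((s , false) ∷ (2 * s , false) ∷ []))
  card-counted-even r =
    card-resp (card-cong (card-⊎ (card-shifted 0F L [] 0<L (card-count H₀ [] []))
                                 (card-shifted 1F L Cs 0<L (card-count H₁ Cs Cs<H₁))
                                 (λ _ → shifted-disjoint L [] Cs 4≤L))
                         shifted→counted counted→shifted)
              (cong₂ _+_ (cong (λ h → count h []) (halfLength-double 0F n)) (cong (λ h → count h Cs) (halfLength-double 1F n)))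
    where
    s n L H₀ H₁ : ℕ
    s = suc r
    n = 2 * s
    L = 2 * n
    H₀ = halfLength 0F L
    H₁ = halfLength 1F L
    Cs : List Constraint
    Cs = (s , false) ∷ (2 * s , false) ∷ []
    0<L : 0 < L
    0<L = s≤s z≤n
    4≤L : 4 ≤ L
    4≤L = *-monoʳ-≤ 2 (*-monoʳ-≤ 2 (s≤s z≤n))
    2s<H₁ : 2 * s < H₁
    2s<H₁ = subst (n <_) (sym (halfLength-double 1F n)) (m<m+n n (s≤s z≤n))
    Cs<H₁ : InRange H₁ Cs
    Cs<H₁ = ≤-<-trans (m≤m+n s (s + 0)) 2s<H₁ ∷ 2s<H₁ ∷ []
    counted→shifted : ∀ u → Counted n u → Shifted 0F L [] u ⊎ Shifted 1F L Cs u
    counted→shifted u cu with Equivalence.to (counted⇔window n) cu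
    ... | i , u≡ , bal with lastDigit i
    ... | k , 0F , refl = inj₁ (Equivalence.from (shifted⇔window 0F L []) (k , u≡ , _))
    ... | k , 1F , refl with Equivalence.to (balanced-odd-even k r) (subst (λ j → Balanced j n) (+-comm (2 * k) 1) bal)
    ... | e₁ , e₂ = inj₂ (Equivalence.from (shifted⇔window 1F L Cs)
                            (k , u≡ , Equivalence.from (satisfies-window k H₁ Cs Cs<H₁) (≡⇒xor≡false e₁ ∷ ≡⇒xor≡false (trans e₁ e₂) ∷ [])))
    shifted→counted : ∀ u → Shifted 0F L [] u ⊎ Shifted 1F L Cs u → Counted n u
    shifted→counted u (inj₁ su) with Equivalence.to (shifted⇔window 0F L []) su
    ... | k , u≡ , _ =
      Equivalence.from (counted⇔window n) (2 * k + 0 , u≡ , subst (λ j → Balanced j n) (sym (+-identityʳ (2 * k))) (balanced-even-even k s))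
    shifted→counted u (inj₂ su) with Equivalence.to (shifted⇔window 1F L Cs) su
    ... | k , u≡ , sat with Equivalence.to (satisfies-window k H₁ Cs Cs<H₁) sat
    ... | e₁ ∷ e₂ ∷ [] =
      Equivalence.from (counted⇔window n) (2 * k + 1 , u≡ , subst (λ j → Balanced j n) (+-comm 1 (2 * k)) bal)
      where
      bal : Balanced (suc (2 * k)) n
      bal = Equivalence.from (balanced-odd-even k r) (xor≡false {t k} e₁ , trans (sym (xor≡false {t k} e₁)) (xor≡false {t k} e₂))

-- Families of constrained factors whose lengths and constraint positions are affine in a parameter.
module AffineFamilies where

  open ThueMorse
  open ConstrainedFactors
  open import Data.Bool using (Bool; _xor_)
  open import Data.Fin using (Fin; toℕ)
  open import Data.Fin.Patterns using (0F; 1F)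
  open import Data.List using (List; []; _∷_; map)
  open import Data.Nat using (ℕ; zero; suc; _+_; _*_; _≤_; ⌊_/2⌋; ⌈_/2⌉)
  open import Data.Nat.Properties
  open import Data.Nat.Tactic.RingSolver using (solve-∀)
  open import Data.Product using (_×_; _,_)
  open import Relation.Binary.PropositionalEquality
  open ≡-Reasoning

  -- An affine constraint (p , q , b) stands for the constraint (p·m + q , b) at parameter m.
  AffineConstraint : Set
  AffineConstraint = ℕ × ℕ × Bool

  at : ℕ → AffineConstraint → Constraint
  at m (p , q , b) = p * m + q , b

  -- A family (q , cs) stands, at parameter m, for the factors of length 2m + q satisfying cs.
  Family : Set
  Family = ℕ × List AffineConstraint

  familyCount : Family → ℕ → ℕ
  familyCount (q , cs) m = count (2 * m + q) (map (at m) cs)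

  -- Splitting the factors of a family at parameter 2m + a by the parity c of their position
  -- yields, at parameter m, the two families child a c.
  childConstraint : Fin 2 → Fin 2 → AffineConstraint → AffineConstraint
  childConstraint a c (p , q , b) = p , ⌊ toℕ c + (p * toℕ a + q) /2⌋ , odd (p * toℕ a + q) xor b

  child : Fin 2 → Fin 2 → Family → Family
  child a c (q , cs) = ⌈ toℕ c + (2 * toℕ a + q) /2⌉ , map (childConstraint a c) cs

  halfLength-2x+r : ∀ c x r → halfLength c (2 * x + r) ≡ x + ⌈ toℕ c + r /2⌉
  halfLength-2x+r c x r = begin
    ⌊ suc (toℕ c + (2 * x + r)) /2⌋   ≡⟨ cong ⌊_/2⌋ (rearrange (toℕ c) x r) ⟩
    ⌊ 2 * x + suc (toℕ c + r) /2⌋     ≡⟨ ⌊2m+r/2⌋ x (suc (toℕ c + r)) ⟩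
    x + ⌈ toℕ c + r /2⌉               ∎
    where
    rearrange : ∀ c x r → suc (c + (2 * x + r)) ≡ 2 * x + suc (c + r)
    rearrange = solve-∀

  shrink-at : ∀ a c m cs → shrink c (map (at (2 * m + toℕ a)) cs) ≡ map (at m) (map (childConstraint a c) cs)
  shrink-at a c m []                  = refl
  shrink-at a c m ((p , q , b) ∷ cs) = cong₂ _∷_ (cong₂ _,_ position flip) (shrink-at a c m cs)
    where
    expand-affine : p * (2 * m + toℕ a) + q ≡ 2 * (p * m) + (p * toℕ a + q)
    expand-affine = solve p m (toℕ a) q
      where
      solve : ∀ p m a q → p * (2 * m + a) + q ≡ 2 * (p * m) + (p * a + q)
      solve = solve-∀
    position : ⌊ toℕ c + (p * (2 * m + toℕ a) + q) /2⌋ ≡ p * m + ⌊ toℕ c + (p * toℕ a + q) /2⌋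
    position = begin
      ⌊ toℕ c + (p * (2 * m + toℕ a) + q) /2⌋    ≡⟨ cong (λ y → ⌊ toℕ c + y /2⌋) expand-affine ⟩
      ⌊ toℕ c + (2 * (p * m) + (p * toℕ a + q)) /2⌋ ≡⟨ cong ⌊_/2⌋ (swap (toℕ c) (p * m) (p * toℕ a + q)) ⟩
      ⌊ 2 * (p * m) + (toℕ c + (p * toℕ a + q)) /2⌋ ≡⟨ ⌊2m+r/2⌋ (p * m) _ ⟩
      p * m + ⌊ toℕ c + (p * toℕ a + q) /2⌋      ∎
      where
      swap : ∀ c x r → c + (2 * x + r) ≡ 2 * x + (c + r)
      swap = solve-∀
    flip : odd (p * (2 * m + toℕ a) + q) xor b ≡ odd (p * toℕ a + q) xor b
    flip = cong (_xor b) (trans (cong odd expand-affine) (odd-2m+r (p * m) (p * toℕ a + q)))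

  -- The recursion satisfied by family counts, valid once the factors have length at least 4.
  familyCount-step : ∀ F a m → 1 ≤ m → familyCount F (2 * m + toℕ a) ≡ familyCount (child a 0F F) m + familyCount (child a 1F F) m
  familyCount-step (q , cs) a m 1≤m = trans (count-split L C 4≤L) (cong₂ _+_ (half 0F) (half 1F))
    where
    L : ℕ
    L = 2 * (2 * m + toℕ a) + q
    C : List Constraint
    C = map (at (2 * m + toℕ a)) cs
    L≡ : L ≡ 2 * (2 * m) + (2 * toℕ a + q)
    L≡ = solve m (toℕ a) q
      where
      solve : ∀ m a q → 2 * (2 * m + a) + q ≡ 2 * (2 * m) + (2 * a + q)
      solve = solve-∀
    4≤L : 4 ≤ L
    4≤L = ≤-trans (*-monoʳ-≤ 2 (*-monoʳ-≤ 2 1≤m)) (subst (2 * (2 * m) ≤_) (sym L≡) (m≤m+n _ _))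
    half : ∀ c → count (halfLength c L) (shrink c C) ≡ familyCount (child a c (q , cs)) m
    half c = cong₂ count (trans (cong (halfLength c) L≡) (halfLength-2x+r c (2 * m) (2 * toℕ a + q))) (shrink-at a c m cs)

-- f, and a finite set of families closed under the 2-kernel recursion.
module AbelianSquareCount where

  open ThueMorse
  open Cardinality
  open ConstrainedFactors
  open AbelianSquares
  open AffineFamilies
  open import Data.Bool using (true; false)
  open import Data.Fin using (Fin; toℕ; #_) renaming (zero to fzero; suc to fsuc)
  open import Data.Fin.Patterns using (0F; 1F)
  open import Data.List using (List; []; _∷_; length)
  open import Data.Nat.ListAction using (sum)
  import Data.List as List
  open import Data.List.Relation.Unary.Any using (here)
  open import Data.List.Membership.Propositional using (_∈_)
  open import Data.List.Relation.Unary.AllPairs using ([]; _∷_)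
  open import Data.List.Relation.Unary.All using ([])
  open import Data.Nat using (ℕ; zero; suc; _+_; _*_; _≤_; z≤n; s≤s; ⌊_/2⌋)
  open import Data.Nat.Properties
  open import Data.Nat.Tactic.RingSolver using (solve-∀)
  open import Data.Product using (_,_)
  open import Data.Vec using (Vec; []; _∷_; lookup; map)
  open import Data.Vec.Properties using (lookup-map)
  open import Function.Bundles using (mk⇔)
  open import Relation.Binary.PropositionalEquality
  open ≡-Reasoning

  -- The three families describing abelian squares (card-counted-even, card-counted-odd).
  squaresEvenStart squaresOddStartEven squaresOddStartOdd : Family
  squaresEvenStart    = 0 , []
  squaresOddStartEven = 1 , (1 , 0 , false) ∷ (2 , 0 , false) ∷ []
  squaresOddStartOdd  = 2 , (2 , 1 , true) ∷ []

  abelianCountAt : Fin 2 → ℕ → ℕ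
  abelianCountAt 0F m = familyCount squaresEvenStart m + familyCount squaresOddStartEven m
  abelianCountAt 1F m = familyCount squaresOddStartOdd m

  lowDigit : ℕ → Fin 2
  lowDigit 0             = 0F
  lowDigit 1             = 1F
  lowDigit (suc (suc n)) = lowDigit n

  abelianCount : ℕ → ℕ
  abelianCount 0             = 1
  abelianCount 1             = 2
  abelianCount (suc (suc n)) = abelianCountAt (lowDigit n) (suc ⌊ n /2⌋)

  lowDigit-2m+a : ∀ m (a : Fin 2) → lowDigit (2 * m + toℕ a) ≡ a
  lowDigit-2m+a zero    0F = refl
  lowDigit-2m+a zero    1F = refl
  lowDigit-2m+a (suc m) a  = trans (cong (λ n → lowDigit (n + toℕ a)) (*-suc 2 m)) (lowDigit-2m+a m a)

  ⌊a/2⌋ : ∀ (a : Fin 2) → ⌊ toℕ a /2⌋ ≡ 0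
  ⌊a/2⌋ 0F = refl
  ⌊a/2⌋ 1F = refl

  abelianCount-digit : ∀ m a → 1 ≤ m → abelianCount (2 * m + toℕ a) ≡ abelianCountAt a m
  abelianCount-digit (suc r) a _ = begin
    abelianCount (2 * suc r + toℕ a)          ≡⟨ cong (λ n → abelianCount (n + toℕ a)) (*-suc 2 r) ⟩
    abelianCount (suc (suc (2 * r + toℕ a)))  ≡⟨ cong₂ (λ d h → abelianCountAt d (suc h)) (lowDigit-2m+a r a) half ⟩
    abelianCountAt a (suc r)                  ∎
    where
    half : ⌊ 2 * r + toℕ a /2⌋ ≡ r
    half = trans (⌊2m+r/2⌋ r (toℕ a)) (trans (cong (r +_) (⌊a/2⌋ a)) (+-identityʳ r))

  card-abelianCountAt : ∀ m a → 1 ≤ m → Card (Counted (2 * m + toℕ a)) (abelianCountAt a m)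
  card-abelianCountAt (suc r) 0F _ =
    subst (λ n → Card (Counted n) (abelianCountAt 0F s)) (sym (+-identityʳ (2 * s)))
      (card-resp (card-counted-even r) (cong (λ cs → count (2 * s + 0) [] + count (2 * s + 1) cs) positions))
    where
    s : ℕ
    s = suc r
    positions : (s , false) ∷ (2 * s , false) ∷ [] ≡ (1 * s + 0 , false) ∷ (2 * s + 0 , false) ∷ []
    positions = cong₂ (λ i j → (i , false) ∷ (j , false) ∷ []) (sym (trans (+-identityʳ (1 * s)) (*-identityˡ s))) (sym (+-identityʳ (2 * s)))
  card-abelianCountAt m 1F _ =
    subst (λ n → Card (Counted n) (abelianCountAt 1F m)) (+-comm 1 (2 * m))
      (card-resp (card-counted-odd m) (cong₂ (λ l i → count l ((i , true) ∷ [])) (length≡ m) (+-comm 1 (2 * m))))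
    where
    length≡ : ∀ m → suc (2 * m) + 1 ≡ 2 * m + 2
    length≡ = solve-∀

  card-abelianCount : ∀ n → Card (Counted n) (abelianCount n)
  card-abelianCount 0 = ([] ∷ []) , ([] ∷ []) , (λ u → mk⇔ to from) , refl
    where
    to : ∀ {u} → u ∈ ([] ∷ []) → Counted 0 u
    to (here refl) = refl , (0 , refl) , ([] , [] , refl , λ _ → refl)
    from : ∀ {u} → Counted 0 u → u ∈ ([] ∷ [])
    from {[]} _ = here refl
  card-abelianCount 1 = card-counted-odd 0
  card-abelianCount (suc (suc n)) with lastDigit n
  ... | k , a , n≡ = subst (λ n → Card (Counted n) (abelianCount n)) (sym n+2≡)
                       (subst (Card (Counted (2 * suc k + toℕ a))) (sym (abelianCount-digit (suc k) a (s≤s z≤n)))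
                         (card-abelianCountAt (suc k) a (s≤s z≤n)))
    where
    n+2≡ : suc (suc n) ≡ 2 * suc k + toℕ a
    n+2≡ = trans (cong (2 +_) n≡) (cong (_+ toℕ a) (sym (*-suc 2 k)))

  -- Twenty-six families, closed under child: child a c sends family i to family childIndex a c i.
  -- The first three are the families of abelian squares above.
  families : Vec Family 26
  families =
    squaresEvenStart ∷ squaresOddStartEven ∷ squaresOddStartOdd ∷
    (1 , []) ∷
    (2 , []) ∷
    (2 , (1 , 0 , true) ∷ (2 , 1 , false) ∷ []) ∷
    (2 , (1 , 1 , true) ∷ (2 , 1 , false) ∷ []) ∷
    (1 , (2 , 0 , false) ∷ []) ∷
    (2 , (2 , 1 , false) ∷ []) ∷
    (3 , (2 , 2 , false) ∷ []) ∷
    (3 , []) ∷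
    (1 , (1 , 0 , true) ∷ (2 , 0 , true) ∷ []) ∷
    (2 , (1 , 0 , true) ∷ (2 , 1 , true) ∷ []) ∷
    (2 , (1 , 0 , false) ∷ (2 , 1 , true) ∷ []) ∷
    (3 , (1 , 1 , false) ∷ (2 , 2 , true) ∷ []) ∷
    (1 , (1 , 0 , false) ∷ (2 , 0 , true) ∷ []) ∷
    (2 , (1 , 1 , false) ∷ (2 , 1 , true) ∷ []) ∷
    (2 , (1 , 1 , true) ∷ (2 , 1 , true) ∷ []) ∷
    (3 , (1 , 1 , true) ∷ (2 , 2 , true) ∷ []) ∷
    (1 , (2 , 0 , true) ∷ []) ∷
    (3 , (2 , 2 , true) ∷ []) ∷
    (1 , (1 , 0 , true) ∷ (2 , 0 , false) ∷ []) ∷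
    (2 , (1 , 0 , false) ∷ (2 , 1 , false) ∷ []) ∷
    (3 , (1 , 1 , false) ∷ (2 , 2 , false) ∷ []) ∷
    (3 , (1 , 1 , true) ∷ (2 , 2 , false) ∷ []) ∷
    (2 , (1 , 1 , false) ∷ (2 , 1 , false) ∷ []) ∷
    []

  childIndex : Fin 2 → Fin 2 → Vec (Fin 26) 26
  childIndex 0F 0F =
    # 0 ∷ # 1 ∷ # 7 ∷ # 3 ∷ # 3 ∷ # 11 ∷ # 15 ∷ # 7 ∷ # 19 ∷ # 8 ∷ # 4 ∷ # 11 ∷ # 21 ∷
    # 1 ∷ # 12 ∷ # 15 ∷ # 21 ∷ # 1 ∷ # 13 ∷ # 19 ∷ # 2 ∷ # 21 ∷ # 15 ∷ # 5 ∷ # 22 ∷ # 11 ∷ []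
  childIndex 0F 1F =
    # 3 ∷ # 1 ∷ # 8 ∷ # 3 ∷ # 4 ∷ # 12 ∷ # 16 ∷ # 7 ∷ # 2 ∷ # 8 ∷ # 4 ∷ # 11 ∷ # 5 ∷
    # 22 ∷ # 17 ∷ # 15 ∷ # 6 ∷ # 25 ∷ # 16 ∷ # 19 ∷ # 2 ∷ # 21 ∷ # 13 ∷ # 6 ∷ # 25 ∷ # 17 ∷ []
  childIndex 1F 0F =
    # 3 ∷ # 5 ∷ # 8 ∷ # 4 ∷ # 4 ∷ # 13 ∷ # 17 ∷ # 8 ∷ # 2 ∷ # 9 ∷ # 10 ∷ # 13 ∷ # 22 ∷
    # 5 ∷ # 14 ∷ # 12 ∷ # 25 ∷ # 6 ∷ # 18 ∷ # 2 ∷ # 20 ∷ # 22 ∷ # 12 ∷ # 23 ∷ # 24 ∷ # 16 ∷ []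
  childIndex 1F 1F =
    # 4 ∷ # 6 ∷ # 9 ∷ # 4 ∷ # 10 ∷ # 14 ∷ # 18 ∷ # 8 ∷ # 20 ∷ # 9 ∷ # 10 ∷ # 16 ∷ # 23 ∷
    # 24 ∷ # 14 ∷ # 17 ∷ # 23 ∷ # 24 ∷ # 18 ∷ # 2 ∷ # 20 ∷ # 25 ∷ # 18 ∷ # 23 ∷ # 24 ∷ # 14 ∷ []

  families-closed : ∀ a c → map (child a c) families ≡ map (lookup families) (childIndex a c)
  families-closed 0F 0F = refl
  families-closed 0F 1F = refl
  families-closed 1F 0F = refl
  families-closed 1F 1F = refl

  child-lookup : ∀ a c i → child a c (lookup families i) ≡ lookup families (lookup (childIndex a c) i)
  child-lookup a c i = trans (sym (lookup-map i (child a c) families))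
    (trans (cong (λ v → lookup v i) (families-closed a c)) (lookup-map i (lookup families) (childIndex a c)))

  sequence : Fin 27 → ℕ → ℕ
  sequence fzero    = abelianCount
  sequence (fsuc i) = familyCount (lookup families i)

  successors : Fin 2 → Fin 27 → List (Fin 27)
  successors a  (fsuc i) = fsuc (lookup (childIndex a 0F) i) ∷ fsuc (lookup (childIndex a 1F) i) ∷ []
  successors 0F fzero    = fsuc (# 0) ∷ fsuc (# 1) ∷ []
  successors 1F fzero    = fsuc (# 2) ∷ []

  sequence-step : ∀ a i m → 1 ≤ m → sequence i (2 * m + toℕ a) ≡ sum (List.map (λ j → sequence j m) (successors a i))
  sequence-step 0F fzero    m 1≤m = trans (abelianCount-digit m 0F 1≤m) (cong (familyCount squaresEvenStart m +_) (sym (+-identityʳ _)))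
  sequence-step 1F fzero    m 1≤m = trans (abelianCount-digit m 1F 1≤m) (sym (+-identityʳ _))
  sequence-step a  (fsuc i) m 1≤m = begin
    familyCount (lookup families i) (2 * m + toℕ a)
      ≡⟨ familyCount-step (lookup families i) a m 1≤m ⟩
    familyCount (child a 0F (lookup families i)) m + familyCount (child a 1F (lookup families i)) m
      ≡⟨ cong₂ (λ F F′ → familyCount F m + familyCount F′ m) (child-lookup a 0F i) (child-lookup a 1F i) ⟩
    sequence (fsuc (lookup (childIndex a 0F) i)) m + sequence (fsuc (lookup (childIndex a 1F) i)) m
      ≡⟨ cong (sequence (fsuc (lookup (childIndex a 0F) i)) m +_) (sym (+-identityʳ _)) ⟩
    sum (List.map (λ j → sequence j m) (successors a (fsuc i))) ∎

-- Finite sums over a commutative ring, and linear relations in a kernel-closed family of sequences.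
module KernelRelations where

  open import Algebra.Bundles using (CommutativeRing)
  open import Data.Fin using (Fin; toℕ) renaming (zero to fzero; suc to fsuc)
  open import Data.List using (List; []; _∷_; foldl)
  import Data.List as List
  open import Data.Nat using (ℕ; zero; suc; _≤_) renaming (_+_ to _+ℕ_; _*_ to _*ℕ_)
  open import Data.Nat.Properties using (≤-trans; m≤m+n)
  open import Data.Vec using (tabulate; lookup)
  open import Data.Vec.Properties using (lookup∘tabulate)
  open import Level using (Level)
  import Relation.Binary.PropositionalEquality as ≡
  open ≡ using (_≡_)

  appendDigits : ℕ → List (Fin 2) → ℕ
  appendDigits m x = foldl (λ acc a → 2 *ℕ acc +ℕ toℕ a) m x

  appendDigits-positive : ∀ m x → 1 ≤ m → 1 ≤ appendDigits m x
  appendDigits-positive m []      1≤m = 1≤m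
  appendDigits-positive m (a ∷ x) 1≤m =
    appendDigits-positive (2 *ℕ m +ℕ toℕ a) x (≤-trans 1≤m (≤-trans (m≤m+n m (m +ℕ 0)) (m≤m+n (2 *ℕ m) (toℕ a))))

  -- Entrywise equality of vectors and tables, read off from the equality of their tabulations
  -- (which is what a computation can check).
  tabulate-≡ : ∀ {A : Set} {n} (f g : Fin n → A) → tabulate f ≡ tabulate g → ∀ i → f i ≡ g i
  tabulate-≡ f g eq i = ≡.trans (≡.sym (lookup∘tabulate f i)) (≡.trans (≡.cong (λ v → lookup v i) eq) (lookup∘tabulate g i))

  tabulate²-≡ : ∀ {A : Set} {m n} (f g : Fin m → Fin n → A) →
    tabulate (λ i → tabulate (f i)) ≡ tabulate (λ i → tabulate (g i)) → ∀ i j → f i j ≡ g i j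
  tabulate²-≡ f g eq i = tabulate-≡ (f i) (g i) (tabulate-≡ (λ i → tabulate (f i)) (λ i → tabulate (g i)) eq i)

  module Sums {c ℓ : Level} (R : CommutativeRing c ℓ) where

    open CommutativeRing R
    open import Algebra.Properties.Semiring.Sum semiring public
    open import Relation.Binary.Reasoning.Setoid setoid

    δ : ∀ {n} → Fin n → Fin n → Carrier
    δ fzero    fzero    = 1#
    δ fzero    (fsuc _) = 0#
    δ (fsuc _) fzero    = 0#
    δ (fsuc i) (fsuc j) = δ i j

    sum-δ : ∀ {n} (i : Fin n) (f : Fin n → Carrier) → ∑[ j < n ] (δ i j * f j) ≈ f i
    sum-δ {suc n} fzero f = begin
      1# * f fzero + ∑[ j < n ] (0# * f (fsuc j))  ≈⟨ +-cong (*-identityˡ _) (trans (sum-cong-≋ (λ j → zeroˡ (f (fsuc j)))) (sum-replicate-zero n)) ⟩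
      f fzero + 0#                                 ≈⟨ +-identityʳ _ ⟩
      f fzero                                      ∎
    sum-δ {suc n} (fsuc i) f = begin
      0# * f fzero + ∑[ j < n ] (δ i j * f (fsuc j)) ≈⟨ +-cong (zeroˡ _) (sum-δ i (λ j → f (fsuc j))) ⟩
      0# + f (fsuc i)                                ≈⟨ +-identityˡ _ ⟩
      f (fsuc i)                                     ∎

    listSum : List Carrier → Carrier
    listSum = List.foldr _+_ 0#

    multiplicity : ∀ {n} → Fin n → List (Fin n) → Carrier
    multiplicity j l = listSum (List.map (λ i → δ i j) l)

    sum-multiplicity : ∀ {n} (l : List (Fin n)) (G : Fin n → Carrier) → ∑[ j < n ] (multiplicity j l * G j) ≈ listSum (List.map G l)
    sum-multiplicity {n} []      G = trans (sum-cong-≋ (λ j → zeroˡ (G j))) (sum-replicate-zero n)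
    sum-multiplicity {n} (i ∷ l) G = begin
      ∑[ j < n ] ((δ i j + multiplicity j l) * G j)               ≈⟨ sum-cong-≋ (λ j → distribʳ (G j) (δ i j) (multiplicity j l)) ⟩
      ∑[ j < n ] (δ i j * G j + multiplicity j l * G j)           ≈⟨ ∑-distrib-+ (λ j → δ i j * G j) (λ j → multiplicity j l * G j) ⟩
      ∑[ j < n ] (δ i j * G j) + ∑[ j < n ] (multiplicity j l * G j) ≈⟨ +-cong (sum-δ i G) (sum-multiplicity l G) ⟩
      G i + listSum (List.map G l)                                ∎

    KernelClosed : ∀ {n} → (Fin n → ℕ → Carrier) → (Fin 2 → Fin n → Fin n → Carrier) → Set ℓ
    KernelClosed {n} G A = ∀ a i m → 1 ≤ m → G i (2 *ℕ m +ℕ toℕ a) ≈ ∑[ j < n ] (A a i j * G j m)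

    combine : ∀ {n d} → (Fin d → Fin n → Carrier) → (Fin n → ℕ → Carrier) → Fin d → ℕ → Carrier
    combine {n} W G l m = ∑[ i < n ] (W l i * G i m)

    ∑-*ˡ : ∀ {k} x (f : Fin k → Carrier) → x * ∑[ j < k ] f j ≈ ∑[ j < k ] (x * f j)
    ∑-*ˡ = *-distribˡ-sum

    ∑-*ʳ : ∀ {k} x (f : Fin k → Carrier) → ∑[ j < k ] f j * x ≈ ∑[ j < k ] (f j * x)
    ∑-*ʳ = *-distribʳ-sum

    *-swapˡ : ∀ x y z → x * (y * z) ≈ y * (x * z)
    *-swapˡ x y z = trans (sym (*-assoc x y z)) (trans (*-congʳ (*-comm x y)) (*-assoc y x z))

    combine-closed : ∀ {n d} (G : Fin n → ℕ → Carrier) A (W : Fin d → Fin n → Carrier) Λ → KernelClosed G A →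
      (∀ a l j → ∑[ i < n ] (W l i * A a i j) ≈ ∑[ l′ < d ] (Λ a l l′ * W l′ j)) → KernelClosed (combine W G) Λ
    combine-closed {n} {d} G A W Λ G-closed intertwine a l m 1≤m = begin
      ∑[ i < n ] (W l i * G i (2 *ℕ m +ℕ toℕ a))                   ≈⟨ sum-cong-≋ (λ i → *-congˡ (G-closed a i m 1≤m)) ⟩
      ∑[ i < n ] (W l i * ∑[ j < n ] (A a i j * G j m))            ≈⟨ sum-cong-≋ (λ i → ∑-*ˡ (W l i) (λ j → A a i j * G j m)) ⟩
      ∑[ i < n ] ∑[ j < n ] (W l i * (A a i j * G j m))            ≈⟨ ∑-comm (λ i j → W l i * (A a i j * G j m)) ⟩
      ∑[ j < n ] ∑[ i < n ] (W l i * (A a i j * G j m))            ≈⟨ sum-cong-≋ (λ j → sum-cong-≋ (λ i → sym (*-assoc (W l i) (A a i j) (G j m)))) ⟩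
      ∑[ j < n ] ∑[ i < n ] (W l i * A a i j * G j m)              ≈⟨ sum-cong-≋ (λ j → sym (∑-*ʳ (G j m) (λ i → W l i * A a i j))) ⟩
      ∑[ j < n ] (∑[ i < n ] (W l i * A a i j) * G j m)            ≈⟨ sum-cong-≋ (λ j → *-congʳ (intertwine a l j)) ⟩
      ∑[ j < n ] (∑[ l′ < d ] (Λ a l l′ * W l′ j) * G j m)         ≈⟨ sum-cong-≋ (λ j → ∑-*ʳ (G j m) (λ l′ → Λ a l l′ * W l′ j)) ⟩
      ∑[ j < n ] ∑[ l′ < d ] (Λ a l l′ * W l′ j * G j m)           ≈⟨ ∑-comm (λ j l′ → Λ a l l′ * W l′ j * G j m) ⟩
      ∑[ l′ < d ] ∑[ j < n ] (Λ a l l′ * W l′ j * G j m)           ≈⟨ sum-cong-≋ (λ l′ → sum-cong-≋ (λ j → *-assoc (Λ a l l′) (W l′ j) (G j m))) ⟩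
      ∑[ l′ < d ] ∑[ j < n ] (Λ a l l′ * (W l′ j * G j m))         ≈⟨ sum-cong-≋ (λ l′ → sym (∑-*ˡ (Λ a l l′) (λ j → W l′ j * G j m))) ⟩
      ∑[ l′ < d ] (Λ a l l′ * ∑[ j < n ] (W l′ j * G j m))         ∎

    Relation : ∀ {d k} → (Fin d → ℕ → Carrier) → Carrier → ℕ → (Fin k → Carrier) → (Fin k → ℕ) → Set ℓ
    Relation {d} {k} Φ c₀ J c s = ∀ l → c₀ * Φ l J ≈ ∑[ κ < k ] (c κ * Φ l (s κ))

    relation-digit : ∀ {d k} (Φ : Fin d → ℕ → Carrier) Λ → KernelClosed Φ Λ →
      ∀ c₀ J (c : Fin k → Carrier) s → 1 ≤ J → (∀ κ → 1 ≤ s κ) → Relation Φ c₀ J c s →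
      ∀ a → Relation Φ c₀ (2 *ℕ J +ℕ toℕ a) c (λ κ → 2 *ℕ s κ +ℕ toℕ a)
    relation-digit {d} {k} Φ Λ closed c₀ J c s 1≤J 1≤s rel a l = begin
      c₀ * Φ l (2 *ℕ J +ℕ toℕ a)                                  ≈⟨ *-congˡ (closed a l J 1≤J) ⟩
      c₀ * ∑[ l′ < d ] (Λ a l l′ * Φ l′ J)                        ≈⟨ ∑-*ˡ c₀ (λ l′ → Λ a l l′ * Φ l′ J) ⟩
      ∑[ l′ < d ] (c₀ * (Λ a l l′ * Φ l′ J))                      ≈⟨ sum-cong-≋ (λ l′ → *-swapˡ c₀ (Λ a l l′) (Φ l′ J)) ⟩
      ∑[ l′ < d ] (Λ a l l′ * (c₀ * Φ l′ J))                      ≈⟨ sum-cong-≋ (λ l′ → *-congˡ (rel l′)) ⟩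
      ∑[ l′ < d ] (Λ a l l′ * ∑[ κ < k ] (c κ * Φ l′ (s κ)))      ≈⟨ sum-cong-≋ (λ l′ → ∑-*ˡ (Λ a l l′) (λ κ → c κ * Φ l′ (s κ))) ⟩
      ∑[ l′ < d ] ∑[ κ < k ] (Λ a l l′ * (c κ * Φ l′ (s κ)))      ≈⟨ ∑-comm (λ l′ κ → Λ a l l′ * (c κ * Φ l′ (s κ))) ⟩
      ∑[ κ < k ] ∑[ l′ < d ] (Λ a l l′ * (c κ * Φ l′ (s κ)))      ≈⟨ sum-cong-≋ (λ κ → sum-cong-≋ (λ l′ → *-swapˡ (Λ a l l′) (c κ) (Φ l′ (s κ)))) ⟩
      ∑[ κ < k ] ∑[ l′ < d ] (c κ * (Λ a l l′ * Φ l′ (s κ)))      ≈⟨ sum-cong-≋ (λ κ → sym (∑-*ˡ (c κ) (λ l′ → Λ a l l′ * Φ l′ (s κ)))) ⟩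
      ∑[ κ < k ] (c κ * ∑[ l′ < d ] (Λ a l l′ * Φ l′ (s κ)))      ≈⟨ sum-cong-≋ (λ κ → *-congˡ (sym (closed a l (s κ) (1≤s κ)))) ⟩
      ∑[ κ < k ] (c κ * Φ l (2 *ℕ s κ +ℕ toℕ a))                  ∎

    relation-append : ∀ {d k} (Φ : Fin d → ℕ → Carrier) Λ → KernelClosed Φ Λ →
      ∀ c₀ J (c : Fin k → Carrier) s → 1 ≤ J → (∀ κ → 1 ≤ s κ) → Relation Φ c₀ J c s →
      ∀ x → Relation Φ c₀ (appendDigits J x) c (λ κ → appendDigits (s κ) x)
    relation-append Φ Λ closed c₀ J c s 1≤J 1≤s rel []      = rel
    relation-append Φ Λ closed c₀ J c s 1≤J 1≤s rel (a ∷ x) =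
      relation-append Φ Λ closed c₀ (2 *ℕ J +ℕ toℕ a) c (λ κ → 2 *ℕ s κ +ℕ toℕ a)
        (appendDigits-positive J (a ∷ []) 1≤J) (λ κ → appendDigits-positive (s κ) (a ∷ []) (1≤s κ))
        (relation-digit Φ Λ closed c₀ J c s 1≤J 1≤s rel a) x

-- The integer certificate: a kernel-closed family containing f and eleven linear relations it satisfies.
module Certificate where

  open AbelianSquareCount
  open KernelRelations
  open import Data.Fin using (Fin; toℕ) renaming (zero to fzero)
  open import Data.Fin.Patterns using (0F; 1F)
  open import Data.Integer using (ℤ; +_; _+_; _*_)
  open import Data.Integer.Literals using (number; negative)
  open import Agda.Builtin.FromNat using (Number)
  open import Agda.Builtin.FromNeg using (Negative)
  open import Data.Integer.Properties using (+-*-commutativeRing; pos-+)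
  open import Data.List using (List; []; _∷_)
  import Data.List as List
  open import Data.Nat using (ℕ; suc; z≤n; s≤s) renaming (_+_ to _+ℕ_; _*_ to _*ℕ_)
  import Data.Nat.ListAction as ℕ
  open import Data.Vec using (Vec; []; _∷_; lookup)
  open import Relation.Binary.PropositionalEquality

  open Sums +-*-commutativeRing

  G : Fin 27 → ℕ → ℤ
  G i m = + sequence i m

  transition : Fin 2 → Fin 27 → Fin 27 → ℤ
  transition a i j = multiplicity j (successors a i)

  +-sum : ∀ (f : Fin 27 → ℕ) l → + ℕ.sum (List.map f l) ≡ listSum (List.map (λ j → + f j) l)
  +-sum f []      = refl
  +-sum f (j ∷ l) = trans (pos-+ (f j) (ℕ.sum (List.map f l))) (cong (λ z → + f j + z) (+-sum f l))

  G-closed : KernelClosed G transition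
  G-closed a i m 1≤m = begin
    + sequence i (2 *ℕ m +ℕ toℕ a)                       ≡⟨ cong +_ (sequence-step a i m 1≤m) ⟩
    + ℕ.sum (List.map (λ j → sequence j m) (successors a i)) ≡⟨ +-sum (λ j → sequence j m) (successors a i) ⟩
    listSum (List.map (λ j → G j m) (successors a i))    ≡⟨ sum-multiplicity (successors a i) (λ j → G j m) ⟨
    ∑[ j < 27 ] (transition a i j * G j m)               ∎
    where open ≡-Reasoning

  module CertificateData where

    open import Agda.Builtin.FromNat using (fromNat)
    open import Agda.Builtin.FromNeg using (fromNeg)
    import Data.Nat.Literals
    open import Data.Unit using (tt)

    instance
      ℕ-number : Number ℕ
      ℕ-number = Data.Nat.Literals.number
      ℤ-number : Number ℤ
      ℤ-number = number
      ℤ-negative : Negative ℤ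
      ℤ-negative = negative

    -- Certificate: 18 integer combinations of the 27 sequences spanning a kernel-closed family
    -- (the first one is f itself), with their transition matrices.
    basisTable : Vec (Vec ℤ 27) 18
    basisTable =
      (1 ∷ 0 ∷ 0 ∷ 0 ∷ 0 ∷ 0 ∷ 0 ∷ 0 ∷ 0 ∷ 0 ∷ 0 ∷ 0 ∷ 0 ∷ 0 ∷ 0 ∷ 0 ∷ 0 ∷ 0 ∷ 0 ∷ 0 ∷ 0 ∷ 0 ∷ 0 ∷ 0 ∷ 0 ∷ 0 ∷ 0 ∷ []) ∷
      (0 ∷ 1 ∷ 1 ∷ 0 ∷ 0 ∷ 0 ∷ 0 ∷ 0 ∷ 0 ∷ 0 ∷ 0 ∷ 0 ∷ 0 ∷ 0 ∷ 0 ∷ 0 ∷ 0 ∷ 0 ∷ 0 ∷ 0 ∷ 0 ∷ 0 ∷ 0 ∷ 0 ∷ 0 ∷ 0 ∷ 0 ∷ []) ∷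
      (0 ∷ 0 ∷ 0 ∷ 1 ∷ 0 ∷ 0 ∷ 0 ∷ 0 ∷ 0 ∷ 0 ∷ 0 ∷ 0 ∷ 0 ∷ 0 ∷ 0 ∷ 0 ∷ 0 ∷ 0 ∷ 0 ∷ 0 ∷ 0 ∷ 0 ∷ 0 ∷ 0 ∷ 0 ∷ 0 ∷ 0 ∷ []) ∷
      (0 ∷ 1 ∷ 2 ∷ 0 ∷ 1 ∷ 0 ∷ 0 ∷ 0 ∷ 0 ∷ 0 ∷ 0 ∷ 0 ∷ 0 ∷ 0 ∷ 0 ∷ 0 ∷ 0 ∷ 0 ∷ 0 ∷ 0 ∷ 0 ∷ 0 ∷ 0 ∷ 0 ∷ 0 ∷ 0 ∷ 0 ∷ []) ∷
      (0 ∷ 0 ∷ 0 ∷ 0 ∷ 1 ∷ 1 ∷ 1 ∷ 1 ∷ 0 ∷ 0 ∷ 0 ∷ 0 ∷ 0 ∷ 0 ∷ 0 ∷ 0 ∷ 0 ∷ 0 ∷ 0 ∷ 0 ∷ 0 ∷ 0 ∷ 0 ∷ 0 ∷ 0 ∷ 0 ∷ 0 ∷ []) ∷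
      (0 ∷ 0 ∷ 0 ∷ 0 ∷ 0 ∷ 0 ∷ 0 ∷ 0 ∷ 1 ∷ 1 ∷ 0 ∷ 0 ∷ 0 ∷ 0 ∷ 0 ∷ 0 ∷ 0 ∷ 0 ∷ 0 ∷ 0 ∷ 0 ∷ 0 ∷ 0 ∷ 0 ∷ 0 ∷ 0 ∷ 0 ∷ []) ∷
      (0 ∷ 0 ∷ 0 ∷ 0 ∷ 0 ∷ 0 ∷ 0 ∷ 0 ∷ 0 ∷ 1 ∷ 1 ∷ 0 ∷ 0 ∷ 0 ∷ 0 ∷ 0 ∷ 0 ∷ 0 ∷ 0 ∷ 0 ∷ 0 ∷ 0 ∷ 0 ∷ 0 ∷ 0 ∷ 0 ∷ 0 ∷ []) ∷
      (0 ∷ 0 ∷ 0 ∷ 0 ∷ 1 ∷ 3 ∷ 2 ∷ 2 ∷ 0 ∷ 0 ∷ 0 ∷ 0 ∷ 0 ∷ 0 ∷ 0 ∷ 0 ∷ 0 ∷ 0 ∷ 0 ∷ 0 ∷ 0 ∷ 0 ∷ 0 ∷ 0 ∷ 0 ∷ 0 ∷ 0 ∷ []) ∷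
      (0 ∷ 0 ∷ 0 ∷ 0 ∷ 3 ∷ 1 ∷ 0 ∷ 0 ∷ 0 ∷ 0 ∷ 0 ∷ 0 ∷ 1 ∷ 1 ∷ 0 ∷ 0 ∷ 1 ∷ 1 ∷ 0 ∷ 0 ∷ 0 ∷ 0 ∷ 0 ∷ 0 ∷ 0 ∷ 0 ∷ 0 ∷ []) ∷
      (0 ∷ 0 ∷ 0 ∷ 0 ∷ 0 ∷ 3 ∷ 0 ∷ 0 ∷ 0 ∷ 0 ∷ 0 ∷ 1 ∷ 0 ∷ 0 ∷ 1 ∷ 1 ∷ 0 ∷ 0 ∷ 1 ∷ 1 ∷ 0 ∷ 0 ∷ 0 ∷ 0 ∷ 0 ∷ 0 ∷ 0 ∷ []) ∷
      (0 ∷ 0 ∷ 0 ∷ 1 ∷ 0 ∷ 0 ∷ 0 ∷ 0 ∷ 2 ∷ 0 ∷ 0 ∷ 0 ∷ 0 ∷ 0 ∷ 0 ∷ 0 ∷ 0 ∷ 0 ∷ 0 ∷ 0 ∷ 1 ∷ 0 ∷ 0 ∷ 0 ∷ 0 ∷ 0 ∷ 0 ∷ []) ∷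
      (0 ∷ 0 ∷ 0 ∷ 1 ∷ 0 ∷ 0 ∷ 0 ∷ 0 ∷ 0 ∷ 2 ∷ 0 ∷ 0 ∷ 0 ∷ 0 ∷ 0 ∷ 0 ∷ 0 ∷ 0 ∷ 0 ∷ 0 ∷ 0 ∷ 1 ∷ 0 ∷ 0 ∷ 0 ∷ 0 ∷ 0 ∷ []) ∷
      (0 ∷ 0 ∷ 0 ∷ 1 ∷ 0 ∷ 0 ∷ 0 ∷ 0 ∷ 0 ∷ 2 ∷ 0 ∷ 0 ∷ 0 ∷ 0 ∷ 0 ∷ 0 ∷ 0 ∷ 0 ∷ 0 ∷ 0 ∷ 1 ∷ 0 ∷ 0 ∷ 0 ∷ 0 ∷ 0 ∷ 0 ∷ []) ∷
      (0 ∷ 0 ∷ 0 ∷ 0 ∷ 0 ∷ 5 ∷ 0 ∷ 0 ∷ 0 ∷ 0 ∷ 0 ∷ 3 ∷ 0 ∷ 0 ∷ 2 ∷ 2 ∷ 0 ∷ 0 ∷ 2 ∷ 2 ∷ 0 ∷ 0 ∷ 0 ∷ 0 ∷ 0 ∷ 0 ∷ 0 ∷ []) ∷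
      (0 ∷ 0 ∷ 0 ∷ 0 ∷ 7 ∷ 1 ∷ 1 ∷ 1 ∷ 0 ∷ 0 ∷ 0 ∷ 0 ∷ 2 ∷ 0 ∷ 0 ∷ 0 ∷ 2 ∷ 0 ∷ 0 ∷ 0 ∷ 0 ∷ 0 ∷ 2 ∷ 0 ∷ 0 ∷ 0 ∷ 0 ∷ []) ∷
      (0 ∷ 0 ∷ 0 ∷ 0 ∷ 0 ∷ 7 ∷ 0 ∷ 0 ∷ 0 ∷ 0 ∷ 0 ∷ 1 ∷ 0 ∷ 1 ∷ 1 ∷ 0 ∷ 0 ∷ 1 ∷ 1 ∷ 0 ∷ 0 ∷ 0 ∷ 0 ∷ 1 ∷ 2 ∷ 0 ∷ 1 ∷ []) ∷
      (0 ∷ 0 ∷ 2 ∷ 0 ∷ 3 ∷ 5 ∷ 0 ∷ 0 ∷ 0 ∷ 0 ∷ 0 ∷ 0 ∷ 0 ∷ 1 ∷ 1 ∷ 0 ∷ 0 ∷ 1 ∷ 1 ∷ 0 ∷ 0 ∷ 0 ∷ 0 ∷ 1 ∷ 0 ∷ 0 ∷ 1 ∷ []) ∷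
      (0 ∷ 0 ∷ 0 ∷ 0 ∷ 0 ∷ 3 ∷ 1 ∷ 1 ∷ 0 ∷ 0 ∷ 0 ∷ 5 ∷ 0 ∷ 0 ∷ 0 ∷ 2 ∷ 0 ∷ 0 ∷ 0 ∷ 2 ∷ 0 ∷ 0 ∷ 0 ∷ 0 ∷ 0 ∷ 2 ∷ 0 ∷ []) ∷
      []

    transitionTable : Fin 2 → Vec (Vec ℤ 18) 18
    transitionTable 0F =
      ( 0 ∷  1 ∷  0 ∷  0 ∷  0 ∷  0 ∷  0 ∷  0 ∷  0 ∷  0 ∷  0 ∷  0 ∷  0 ∷  0 ∷  0 ∷  0 ∷  0 ∷  0 ∷ []) ∷
      ( 0 ∷  0 ∷  0 ∷  1 ∷  0 ∷  0 ∷  0 ∷  0 ∷  0 ∷  0 ∷  0 ∷  0 ∷  0 ∷  0 ∷  0 ∷  0 ∷  0 ∷  0 ∷ []) ∷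
      ( 0 ∷  0 ∷  0 ∷  0 ∷  0 ∷  1 ∷  0 ∷  0 ∷  0 ∷  0 ∷  0 ∷  0 ∷  0 ∷  0 ∷  0 ∷  0 ∷  0 ∷  0 ∷ []) ∷
      ( 0 ∷ -2 ∷  0 ∷  3 ∷  0 ∷  0 ∷  0 ∷  0 ∷  0 ∷  0 ∷  0 ∷  0 ∷  0 ∷  0 ∷  0 ∷  0 ∷  0 ∷  0 ∷ []) ∷
      ( 0 ∷  0 ∷  0 ∷  0 ∷  0 ∷  0 ∷  0 ∷  0 ∷  1 ∷  0 ∷  0 ∷  0 ∷  0 ∷  0 ∷  0 ∷  0 ∷  0 ∷  0 ∷ []) ∷
      ( 0 ∷  0 ∷  0 ∷  0 ∷  0 ∷  0 ∷  0 ∷  0 ∷  0 ∷  0 ∷  1 ∷  0 ∷  0 ∷  0 ∷  0 ∷  0 ∷  0 ∷  0 ∷ []) ∷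
      ( 0 ∷  0 ∷  0 ∷  0 ∷  0 ∷  0 ∷  0 ∷  0 ∷  0 ∷  0 ∷  0 ∷  0 ∷  1 ∷  0 ∷  0 ∷  0 ∷  0 ∷  0 ∷ []) ∷
      ( 0 ∷  0 ∷  0 ∷  0 ∷ -2 ∷  0 ∷  0 ∷  1 ∷  2 ∷  0 ∷  0 ∷  0 ∷  0 ∷  0 ∷  0 ∷  0 ∷  0 ∷  0 ∷ []) ∷
      ( 0 ∷  0 ∷  0 ∷  0 ∷  0 ∷  0 ∷  0 ∷  0 ∷  0 ∷  0 ∷  0 ∷  0 ∷  0 ∷  0 ∷  1 ∷  0 ∷  0 ∷  0 ∷ []) ∷
      ( 0 ∷  0 ∷  0 ∷  0 ∷  0 ∷  0 ∷  0 ∷  0 ∷  0 ∷  0 ∷  0 ∷  0 ∷  0 ∷  0 ∷  0 ∷  0 ∷  1 ∷  0 ∷ []) ∷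
      ( 0 ∷  0 ∷ -2 ∷  0 ∷  0 ∷  1 ∷  0 ∷  0 ∷  0 ∷  0 ∷  2 ∷  0 ∷  0 ∷  0 ∷  0 ∷  0 ∷  0 ∷  0 ∷ []) ∷
      ( 0 ∷  0 ∷  2 ∷  0 ∷  0 ∷ -1 ∷  0 ∷  0 ∷  0 ∷  0 ∷  1 ∷  0 ∷  1 ∷  0 ∷  0 ∷  0 ∷  0 ∷  0 ∷ []) ∷
      ( 0 ∷  0 ∷ -2 ∷  0 ∷  0 ∷ -3 ∷  0 ∷  0 ∷  0 ∷  0 ∷  2 ∷  0 ∷  2 ∷  0 ∷  0 ∷  0 ∷  0 ∷  0 ∷ []) ∷
      ( 0 ∷  0 ∷  0 ∷  0 ∷ -2 ∷  0 ∷  0 ∷  1 ∷  0 ∷  0 ∷  0 ∷  0 ∷  0 ∷  0 ∷  0 ∷  0 ∷  2 ∷  0 ∷ []) ∷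
      ( 0 ∷  0 ∷  0 ∷  0 ∷ -2 ∷  0 ∷  0 ∷  0 ∷  1 ∷  0 ∷  0 ∷  0 ∷  0 ∷  0 ∷  2 ∷  0 ∷  0 ∷  0 ∷ []) ∷
      ( 0 ∷  0 ∷  0 ∷  0 ∷ -2 ∷  0 ∷  0 ∷  2 ∷ -1 ∷  0 ∷  0 ∷  0 ∷  0 ∷  0 ∷  1 ∷  0 ∷  1 ∷  0 ∷ []) ∷
      ( 0 ∷ -4 ∷  0 ∷  4 ∷  0 ∷  0 ∷  0 ∷  0 ∷ -1 ∷  0 ∷  0 ∷  0 ∷  0 ∷  0 ∷  1 ∷  0 ∷  1 ∷  0 ∷ []) ∷
      ( 0 ∷  4 ∷  0 ∷ -4 ∷ -4 ∷  0 ∷  0 ∷  2 ∷  1 ∷  0 ∷  0 ∷  0 ∷  0 ∷  0 ∷  0 ∷  0 ∷  2 ∷  0 ∷ []) ∷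
      []
    transitionTable 1F =
      ( 0 ∷  0 ∷  1 ∷  0 ∷  0 ∷  0 ∷  0 ∷  0 ∷  0 ∷  0 ∷  0 ∷  0 ∷  0 ∷  0 ∷  0 ∷  0 ∷  0 ∷  0 ∷ []) ∷
      ( 0 ∷  0 ∷  0 ∷  0 ∷  1 ∷  0 ∷  0 ∷  0 ∷  0 ∷  0 ∷  0 ∷  0 ∷  0 ∷  0 ∷  0 ∷  0 ∷  0 ∷  0 ∷ []) ∷
      ( 0 ∷  0 ∷  0 ∷  0 ∷  0 ∷  0 ∷  1 ∷  0 ∷  0 ∷  0 ∷  0 ∷  0 ∷  0 ∷  0 ∷  0 ∷  0 ∷  0 ∷  0 ∷ []) ∷
      ( 0 ∷  0 ∷  0 ∷  0 ∷  0 ∷  0 ∷  0 ∷  1 ∷  0 ∷  0 ∷  0 ∷  0 ∷  0 ∷  0 ∷  0 ∷  0 ∷  0 ∷  0 ∷ []) ∷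
      ( 0 ∷  0 ∷  0 ∷  0 ∷  0 ∷  0 ∷  0 ∷  0 ∷  0 ∷  1 ∷  0 ∷  0 ∷  0 ∷  0 ∷  0 ∷  0 ∷  0 ∷  0 ∷ []) ∷
      ( 0 ∷  0 ∷  0 ∷  0 ∷  0 ∷  0 ∷  0 ∷  0 ∷  0 ∷  0 ∷  0 ∷  1 ∷  0 ∷  0 ∷  0 ∷  0 ∷  0 ∷  0 ∷ []) ∷
      ( 0 ∷  0 ∷  0 ∷  0 ∷  0 ∷ -2 ∷  2 ∷  0 ∷  0 ∷  0 ∷  1 ∷  1 ∷ -1 ∷  0 ∷  0 ∷  0 ∷  0 ∷  0 ∷ []) ∷
      ( 0 ∷  0 ∷  0 ∷  0 ∷  0 ∷  0 ∷  0 ∷  0 ∷  0 ∷  0 ∷  0 ∷  0 ∷  0 ∷  1 ∷  0 ∷  0 ∷  0 ∷  0 ∷ []) ∷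
      ( 0 ∷  0 ∷  0 ∷  0 ∷  0 ∷  0 ∷  0 ∷  0 ∷  0 ∷  0 ∷  0 ∷  0 ∷  0 ∷  0 ∷  0 ∷  1 ∷  0 ∷  0 ∷ []) ∷
      ( 0 ∷  0 ∷  0 ∷  0 ∷  0 ∷  0 ∷  0 ∷  0 ∷  0 ∷  0 ∷  0 ∷  0 ∷  0 ∷  0 ∷  0 ∷  0 ∷  0 ∷  1 ∷ []) ∷
      ( 0 ∷  0 ∷  2 ∷  0 ∷  0 ∷  2 ∷  1 ∷  0 ∷  0 ∷  0 ∷ -1 ∷  0 ∷  1 ∷  0 ∷  0 ∷  0 ∷  0 ∷  0 ∷ []) ∷
      ( 0 ∷  0 ∷ -2 ∷  0 ∷  0 ∷ -4 ∷  1 ∷  0 ∷  0 ∷  0 ∷  2 ∷  4 ∷ -2 ∷  0 ∷  0 ∷  0 ∷  0 ∷  0 ∷ []) ∷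
      ( 0 ∷  0 ∷  2 ∷  0 ∷  0 ∷ -2 ∷  1 ∷  0 ∷  0 ∷  0 ∷  1 ∷  2 ∷ -1 ∷  0 ∷  0 ∷  0 ∷  0 ∷  0 ∷ []) ∷
      ( 0 ∷  0 ∷  0 ∷  0 ∷  0 ∷  0 ∷  0 ∷  0 ∷  0 ∷ -2 ∷  0 ∷  0 ∷  0 ∷  1 ∷  0 ∷  0 ∷  0 ∷  2 ∷ []) ∷
      ( 0 ∷  4 ∷  0 ∷ -4 ∷ -4 ∷  0 ∷  0 ∷  2 ∷  0 ∷  1 ∷  0 ∷  0 ∷  0 ∷  0 ∷  0 ∷  0 ∷  2 ∷  0 ∷ []) ∷
      ( 0 ∷ -4 ∷  0 ∷  4 ∷  4 ∷  0 ∷  0 ∷ -2 ∷  0 ∷ -5 ∷  0 ∷  0 ∷  0 ∷  2 ∷  0 ∷  3 ∷ -2 ∷  1 ∷ []) ∷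
      ( 0 ∷  0 ∷  0 ∷  0 ∷ -2 ∷  0 ∷  0 ∷  2 ∷  0 ∷ -1 ∷  0 ∷  0 ∷  0 ∷  0 ∷  0 ∷  1 ∷  0 ∷  1 ∷ []) ∷
      ( 0 ∷  0 ∷  0 ∷  0 ∷  2 ∷  0 ∷  0 ∷ -2 ∷  0 ∷ -3 ∷  0 ∷  0 ∷  0 ∷  2 ∷  0 ∷  0 ∷  0 ∷  2 ∷ []) ∷
      []

    -- Certificate: eleven linear relations, relation r expressing denominator r · f(11 + r) through f(2), …, f(10).
    denominatorTable : Vec ℤ 11
    denominatorTable = 13 ∷ 26 ∷ 26 ∷ 26 ∷ 26 ∷ 1 ∷ 13 ∷ 13 ∷ 13 ∷ 13 ∷ 13 ∷ []

    coefficientTable : Vec (Vec ℤ 9) 11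
    coefficientTable =
      (  -8 ∷    0 ∷   -8 ∷   10 ∷    0 ∷    0 ∷   16 ∷    7 ∷   -4 ∷ []) ∷
      ( 128 ∷   26 ∷ -171 ∷  -69 ∷    0 ∷    0 ∷   43 ∷   18 ∷   51 ∷ []) ∷
      (-174 ∷  -26 ∷  203 ∷    3 ∷   52 ∷    0 ∷   -3 ∷   32 ∷  -61 ∷ []) ∷
      ( 180 ∷  -26 ∷ -275 ∷    9 ∷    0 ∷   52 ∷   69 ∷  -34 ∷   51 ∷ []) ∷
      ( -14 ∷   26 ∷   25 ∷  -93 ∷    0 ∷    0 ∷   15 ∷   74 ∷   -7 ∷ []) ∷
      (  -2 ∷    0 ∷    1 ∷    0 ∷    0 ∷    0 ∷    2 ∷    0 ∷    0 ∷ []) ∷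
      (  20 ∷    0 ∷  -45 ∷  -12 ∷    0 ∷    0 ∷   25 ∷   28 ∷   -3 ∷ []) ∷
      (  68 ∷    0 ∷  -88 ∷  -33 ∷    0 ∷    0 ∷   20 ∷   12 ∷   34 ∷ []) ∷
      ( -40 ∷    0 ∷   25 ∷   -2 ∷    0 ∷    0 ∷   15 ∷   22 ∷   -7 ∷ []) ∷
      (  54 ∷    0 ∷  -89 ∷  -22 ∷    0 ∷    0 ∷   35 ∷    8 ∷   27 ∷ []) ∷
      ( -36 ∷    0 ∷   29 ∷  -20 ∷    0 ∷    0 ∷    7 ∷   38 ∷   -5 ∷ []) ∷
      []

  open CertificateData

  W : Fin 18 → Fin 27 → ℤ
  W l i = lookup (lookup basisTable l) i

  Λ : Fin 2 → Fin 18 → Fin 18 → ℤ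
  Λ a l l′ = lookup (lookup (transitionTable a) l) l′

  intertwine : ∀ a l j → ∑[ i < 27 ] (W l i * transition a i j) ≡ ∑[ l′ < 18 ] (Λ a l l′ * W l′ j)
  intertwine 0F = tabulate²-≡ _ _ refl
  intertwine 1F = tabulate²-≡ _ _ refl

  Φ : Fin 18 → ℕ → ℤ
  Φ = combine W G

  Φ-closed : KernelClosed Φ Λ
  Φ-closed = combine-closed G transition W Λ G-closed intertwine

  Φ-f : ∀ m → Φ fzero m ≡ + abelianCount m
  Φ-f m = trans (sum-cong-≋ (λ i → cong (_* G i m) (tabulate-≡ (W fzero) (δ fzero) refl i))) (sum-δ fzero (λ i → G i m))

  denominator : Fin 11 → ℤ
  denominator r = lookup denominatorTable r

  coefficient : Fin 11 → Fin 9 → ℤ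
  coefficient r κ = lookup (lookup coefficientTable r) κ

  relations-base : ∀ r → Relation Φ (denominator r) (11 +ℕ toℕ r) (coefficient r) (λ κ → 2 +ℕ toℕ κ)
  relations-base = tabulate²-≡ (λ r l → denominator r * Φ l (11 +ℕ toℕ r)) (λ r l → ∑[ κ < 9 ] (coefficient r κ * Φ l (2 +ℕ toℕ κ))) refl

  abelian-relation : ∀ r x → denominator r * + abelianCount (appendDigits (11 +ℕ toℕ r) x)
                             ≡ ∑[ κ < 9 ] (coefficient r κ * + abelianCount (appendDigits (2 +ℕ toℕ κ) x))
  abelian-relation r x = begin
    denominator r * + abelianCount (appendDigits (11 +ℕ toℕ r) x)   ≡⟨ cong (denominator r *_) (Φ-f (appendDigits (11 +ℕ toℕ r) x)) ⟨
    denominator r * Φ fzero (appendDigits (11 +ℕ toℕ r) x)           ≡⟨ relation-append Φ Λ Φ-closed (denominator r) (11 +ℕ toℕ r) (coefficient r) (λ κ → 2 +ℕ toℕ κ)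
                                                                           (s≤s z≤n) (λ κ → s≤s z≤n) (relations-base r) x fzero ⟩
    ∑[ κ < 9 ] (coefficient r κ * Φ fzero (appendDigits (2 +ℕ toℕ κ) x)) ≡⟨ sum-cong-≋ (λ κ → cong (coefficient r κ *_) (Φ-f (appendDigits (2 +ℕ toℕ κ) x))) ⟩
    ∑[ κ < 9 ] (coefficient r κ * + abelianCount (appendDigits (2 +ℕ toℕ κ) x)) ∎
    where open ≡-Reasoning

-- From the integer relations to the rational linear representation (v, M₀, M₁, w).
module LinearRepresentation where

  open KernelRelations
  open AbelianSquareCount using (abelianCount)
  open Certificate using (denominator; coefficient; abelian-relation)
  open import Data.Fin using (Fin; toℕ; fromℕ<) renaming (zero to fzero; suc to fsuc)
  open import Data.Fin.Patterns using (0F; 1F)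
  open import Data.Fin.Properties using (toℕ-fromℕ<; toℕ<n)
  open import Data.Integer using (ℤ; +_)
  import Data.Integer as ℤ
  import Data.Integer.Properties as ℤ
  import Data.Integer.GCD as ℤ
  open import Data.List using (List; []; _∷_; foldl)
  open import Data.Nat using (ℕ; zero; suc; _<_; _≤_; _∸_; _<?_)
  import Data.Nat as ℕ
  import Data.Nat.Properties as ℕ
  import Data.Nat.GCD as ℕ
  open import Data.Rational using (ℚ; _/_; ↥_; ↧_; toℚᵘ; 0ℚ; 1ℚ) renaming (_+_ to _+q_; _*_ to _*q_)
  import Data.Rational.Properties as ℚ
  open import Data.Rational.Unnormalised using (mkℚᵘ; *≡*) renaming (_≃_ to _≃ᵘ_; _+_ to _+ᵘ_)
  import Data.Rational.Unnormalised as ℚᵘ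
  import Data.Rational.Unnormalised.Properties as ℚᵘ
  open import Data.Vec using (Vec; []; _∷_; lookup; tabulate; foldr)
  open import Data.Vec.Properties using (lookup∘tabulate)
  open import Relation.Nullary using (Dec; yes; no)
  open import Relation.Binary.PropositionalEquality
  open ≡-Reasoning

  module ℤΣ = Sums ℤ.+-*-commutativeRing
  module ℚΣ = Sums ℚ.+-*-commutativeRing
  open ℚΣ using (sum; sum-syntax; δ; sum-δ; sum-cong-≋; ∑-comm; ∑-*ˡ; ∑-*ʳ)

  ι : ℤ → ℚ
  ι z = z / 1

  toℚᵘ-ι : ∀ z → toℚᵘ (ι z) ≃ᵘ mkℚᵘ z 0
  toℚᵘ-ι z = *≡* (cong₂ ℤ._*_ numerator (sym denominator′))
    where
    gcd-1 : ℤ.gcd z (+ 1) ≡ + 1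
    gcd-1 = cong +_ (ℕ.gcd-zeroʳ ℤ.∣ z ∣)
    numerator : ℚᵘ.↥ (toℚᵘ (ι z)) ≡ z
    numerator = trans (ℚ.↥ᵘ-toℚᵘ (ι z)) (trans (sym (ℤ.*-identityʳ _)) (trans (cong (↥ (ι z) ℤ.*_) (sym gcd-1)) (ℚ.↥-/ z 1)))
    denominator′ : ℚᵘ.↧ (toℚᵘ (ι z)) ≡ + 1
    denominator′ = trans (ℚ.↧ᵘ-toℚᵘ (ι z)) (trans (sym (ℤ.*-identityʳ _)) (trans (cong (↧ (ι z) ℤ.*_) (sym gcd-1)) (ℚ.↧-/ z 1)))

  ι-+ : ∀ a b → ι (a ℤ.+ b) ≡ ι a +q ι b
  ι-+ a b = ℚ.toℚᵘ-injective (ℚᵘ.≃-trans (toℚᵘ-ι (a ℤ.+ b)) (ℚᵘ.≃-trans sum-of-integers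
    (ℚᵘ.≃-sym (ℚᵘ.≃-trans (ℚ.toℚᵘ-homo-+ (ι a) (ι b)) (ℚᵘ.+-cong (toℚᵘ-ι a) (toℚᵘ-ι b))))))
    where
    sum-of-integers : mkℚᵘ (a ℤ.+ b) 0 ≃ᵘ (mkℚᵘ a 0 +ᵘ mkℚᵘ b 0)
    sum-of-integers = *≡* (cong₂ (λ x y → (x ℤ.+ y) ℤ.* + 1) (sym (ℤ.*-identityʳ a)) (sym (ℤ.*-identityʳ b)))

  ι-* : ∀ a b → ι (a ℤ.* b) ≡ ι a *q ι b
  ι-* a b = ℚ.toℚᵘ-injective (ℚᵘ.≃-trans (toℚᵘ-ι (a ℤ.* b))
    (ℚᵘ.≃-sym (ℚᵘ.≃-trans (ℚ.toℚᵘ-homo-* (ι a) (ι b)) (ℚᵘ.*-cong (toℚᵘ-ι a) (toℚᵘ-ι b)))))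

  ι-∑ : ∀ {n} (f : Fin n → ℤ) → ι (ℤΣ.sum f) ≡ ℚΣ.sum (λ i → ι (f i))
  ι-∑ {zero}  f = refl
  ι-∑ {suc n} f = trans (ι-+ (f fzero) (ℤΣ.sum (λ i → f (fsuc i)))) (cong (ι (f fzero) +q_) (ι-∑ (λ i → f (fsuc i))))

  foldr-tabulate : ∀ {n} (f : Fin n → ℚ) → foldr (λ _ → ℚ) _+q_ 0ℚ (tabulate f) ≡ sum f
  foldr-tabulate {zero}  f = refl
  foldr-tabulate {suc n} f = cong (f fzero +q_) (foldr-tabulate (λ i → f (fsuc i)))

  dot≡∑ : ∀ u w → dot u w ≡ ∑[ j < 11 ] (lookup u j *q lookup w j)
  dot≡∑ u w = foldr-tabulate (λ j → lookup u j *q lookup w j)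

  lookup-· : ∀ u N k → lookup (u · N) k ≡ ∑[ i < 11 ] (lookup u i *q lookup (lookup N i) k)
  lookup-· u N k = begin
    lookup (u · N) k                                         ≡⟨ lookup∘tabulate (λ j → dot u (tabulate (λ i → lookup (lookup N i) j))) k ⟩
    dot u (tabulate (λ i → lookup (lookup N i) k))           ≡⟨ dot≡∑ u (tabulate (λ i → lookup (lookup N i) k)) ⟩
    ∑[ i < 11 ] (lookup u i *q lookup (tabulate (λ i → lookup (lookup N i) k)) i) ≡⟨ sum-cong-≋ (λ i → cong (lookup u i *q_) (lookup∘tabulate (λ i → lookup (lookup N i) k) i)) ⟩
    ∑[ i < 11 ] (lookup u i *q lookup (lookup N i) k)        ∎

  represent : ∀ (N : Fin 2 → Mat) (w : RowV) (F : Fin 11 → List (Fin 2) → ℚ) →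
    (∀ a i x → F i (a ∷ x) ≡ ∑[ k < 11 ] (lookup (lookup (N a) i) k *q F k x)) → (∀ j → lookup w j ≡ F j []) →
    ∀ x u → dot (foldl (λ u d → u · N d) u x) w ≡ ∑[ j < 11 ] (lookup u j *q F j x)
  represent N w F rows w≡ [] u = trans (dot≡∑ u w) (sum-cong-≋ (λ j → cong (lookup u j *q_) (w≡ j)))
  represent N w F rows w≡ (a ∷ x) u = begin
    dot (foldl (λ u d → u · N d) (u · N a) x) w                                ≡⟨ represent N w F rows w≡ x (u · N a) ⟩
    ∑[ k < 11 ] (lookup (u · N a) k *q F k x)                                  ≡⟨ sum-cong-≋ (λ k → cong (_*q F k x) (lookup-· u (N a) k)) ⟩
    ∑[ k < 11 ] (∑[ i < 11 ] (lookup u i *q lookup (lookup (N a) i) k) *q F k x) ≡⟨ sum-cong-≋ (λ k → ∑-*ʳ (F k x) (λ i → lookup u i *q lookup (lookup (N a) i) k)) ⟩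
    ∑[ k < 11 ] ∑[ i < 11 ] (lookup u i *q lookup (lookup (N a) i) k *q F k x)   ≡⟨ ∑-comm (λ k i → lookup u i *q lookup (lookup (N a) i) k *q F k x) ⟩
    ∑[ i < 11 ] ∑[ k < 11 ] (lookup u i *q lookup (lookup (N a) i) k *q F k x)   ≡⟨ sum-cong-≋ (λ i → sum-cong-≋ (λ k → ℚ.*-assoc (lookup u i) (lookup (lookup (N a) i) k) (F k x))) ⟩
    ∑[ i < 11 ] ∑[ k < 11 ] (lookup u i *q (lookup (lookup (N a) i) k *q F k x)) ≡⟨ sum-cong-≋ (λ i → sym (∑-*ˡ (lookup u i) (λ k → lookup (lookup (N a) i) k *q F k x))) ⟩
    ∑[ i < 11 ] (lookup u i *q ∑[ k < 11 ] (lookup (lookup (N a) i) k *q F k x)) ≡⟨ sum-cong-≋ (λ i → cong (lookup u i *q_) (sym (rows a i x))) ⟩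
    ∑[ i < 11 ] (lookup u i *q F i (a ∷ x))                                      ∎

  valueAfter : Fin 11 → List (Fin 2) → ℚ
  valueAfter j x = ι (+ abelianCount (appendDigits (toℕ j) x))

  -- Rows of the matrices: unit rows, and rows expressing f(11 + r) through f(2), …, f(10).
  unitRow : Fin 11 → RowV
  unitRow j = tabulate (δ j)

  relationCoefficient : Fin 11 → Fin 11 → ℤ
  relationCoefficient r fzero           = + 0
  relationCoefficient r (fsuc fzero)    = + 0
  relationCoefficient r (fsuc (fsuc κ)) = coefficient r κ

  inverseDenominator : Fin 11 → ℚ
  inverseDenominator r = lookup (p 1 13 ∷ p 1 26 ∷ p 1 26 ∷ p 1 26 ∷ p 1 26 ∷ p 1 1 ∷ p 1 13 ∷ p 1 13 ∷ p 1 13 ∷ p 1 13 ∷ p 1 13 ∷ []) r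

  inverseDenominator-inverse : ∀ r → inverseDenominator r *q ι (denominator r) ≡ 1ℚ
  inverseDenominator-inverse = tabulate-≡ _ (λ _ → 1ℚ) refl

  relationRow : Fin 11 → RowV
  relationRow r = tabulate λ k → ι (relationCoefficient r k) *q inverseDenominator r

  rowFor : ∀ J → J < 22 → Dec (J < 11) → RowV
  rowFor J _    (yes J<11) = unitRow (fromℕ< J<11)
  rowFor J J<22 (no _)     = relationRow (fromℕ< (ℕ.m<n+o⇒m∸n<o J 11 J<22))

  -- Row i of M a computes F at 2i + a.
  target : Fin 2 → Fin 11 → ℕ
  target a i = 2 ℕ.* toℕ i ℕ.+ toℕ a

  target<22 : ∀ a i → target a i < 22
  target<22 a i = subst (_≤ 22) (ℕ.+-suc (2 ℕ.* toℕ i) (toℕ a)) (ℕ.+-mono-≤ (ℕ.*-monoʳ-≤ 2 (ℕ.≤-pred (toℕ<n i))) (toℕ<n a))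

  rows-of-M : ∀ a i → lookup (M a) i ≡ rowFor (target a i) (target<22 a i) (target a i <? 11)
  rows-of-M 0F = tabulate-≡ _ _ refl
  rows-of-M 1F = tabulate-≡ _ _ refl

  unitRow-value : ∀ j x → ∑[ k < 11 ] (lookup (unitRow j) k *q valueAfter k x) ≡ valueAfter j x
  unitRow-value j x = trans (sum-cong-≋ (λ k → cong (_*q valueAfter k x) (lookup∘tabulate (δ j) k))) (sum-δ j (λ k → valueAfter k x))

  relationRow-value : ∀ r x → ∑[ k < 11 ] (lookup (relationRow r) k *q valueAfter k x) ≡ ι (+ abelianCount (appendDigits (11 ℕ.+ toℕ r) x))
  relationRow-value r x = begin
    ∑[ k < 11 ] (lookup (relationRow r) k *q ι (v k))               ≡⟨ sum-cong-≋ (λ k → cong (_*q ι (v k)) (lookup∘tabulate (λ k → ι (c k) *q q) k)) ⟩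
    ∑[ k < 11 ] (ι (c k) *q q *q ι (v k))                           ≡⟨ sum-cong-≋ rearrange ⟩
    ∑[ k < 11 ] (q *q ι (c k ℤ.* v k))                              ≡⟨ ∑-*ˡ q (λ k → ι (c k ℤ.* v k)) ⟨
    q *q ∑[ k < 11 ] ι (c k ℤ.* v k)                                ≡⟨ cong (q *q_) (ι-∑ (λ k → c k ℤ.* v k)) ⟨
    q *q ι (ℤΣ.sum (λ k → c k ℤ.* v k))                             ≡⟨ cong (λ z → q *q ι z) (trans (ℤ.+-identityˡ _) (ℤ.+-identityˡ (ℤΣ.sum (λ κ → coefficient r κ ℤ.* v (fsuc (fsuc κ)))))) ⟩
    q *q ι (ℤΣ.sum (λ κ → coefficient r κ ℤ.* v (fsuc (fsuc κ))))  ≡⟨ cong (λ z → q *q ι z) (abelian-relation r x) ⟨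
    q *q ι (denominator r ℤ.* fJ)                                   ≡⟨ cong (q *q_) (ι-* (denominator r) fJ) ⟩
    q *q (ι (denominator r) *q ι fJ)                                ≡⟨ ℚ.*-assoc q (ι (denominator r)) (ι fJ) ⟨
    q *q ι (denominator r) *q ι fJ                                  ≡⟨ cong (_*q ι fJ) (inverseDenominator-inverse r) ⟩
    1ℚ *q ι fJ                                                      ≡⟨ ℚ.*-identityˡ (ι fJ) ⟩
    ι fJ                                                            ∎
    where
    q : ℚ
    q = inverseDenominator r
    c : Fin 11 → ℤ
    c = relationCoefficient r
    v : Fin 11 → ℤ
    v k = + abelianCount (appendDigits (toℕ k) x)
    fJ : ℤ
    fJ = + abelianCount (appendDigits (11 ℕ.+ toℕ r) x)
    rearrange : ∀ k → ι (c k) *q q *q ι (v k) ≡ q *q ι (c k ℤ.* v k)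
    rearrange k = begin
      ι (c k) *q q *q ι (v k)      ≡⟨ cong (_*q ι (v k)) (ℚ.*-comm (ι (c k)) q) ⟩
      q *q ι (c k) *q ι (v k)      ≡⟨ ℚ.*-assoc q (ι (c k)) (ι (v k)) ⟩
      q *q (ι (c k) *q ι (v k))    ≡⟨ cong (q *q_) (ι-* (c k) (v k)) ⟨
      q *q ι (c k ℤ.* v k)         ∎

  row-value : ∀ J (J<22 : J < 22) d x → ∑[ k < 11 ] (lookup (rowFor J J<22 d) k *q valueAfter k x) ≡ ι (+ abelianCount (appendDigits J x))
  row-value J J<22 (yes J<11) x =
    trans (unitRow-value (fromℕ< J<11) x) (cong (λ n → ι (+ abelianCount (appendDigits n x))) (toℕ-fromℕ< J<11))
  row-value J J<22 (no J≮11)  x =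
    trans (relationRow-value r x) (cong (λ n → ι (+ abelianCount (appendDigits n x))) J≡)
    where
    r<11 : J ∸ 11 < 11
    r<11 = ℕ.m<n+o⇒m∸n<o J 11 J<22
    r : Fin 11
    r = fromℕ< r<11
    J≡ : 11 ℕ.+ toℕ r ≡ J
    J≡ = trans (cong (11 ℕ.+_) (toℕ-fromℕ< r<11)) (ℕ.m+[n∸m]≡n (ℕ.≮⇒≥ J≮11))

  linRep≡f : ∀ ds → linRep ds ≡ ι (+ abelianCount (value ds))
  linRep≡f ds = begin
    dot (foldl (λ u d → u · M d) vVec ds) wVec      ≡⟨ represent M wVec valueAfter rows w≡ ds vVec ⟩
    ∑[ j < 11 ] (lookup vVec j *q valueAfter j ds)  ≡⟨ sum-cong-≋ (λ j → cong (_*q valueAfter j ds) (v≡ j)) ⟩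
    ∑[ j < 11 ] (δ 0F j *q valueAfter j ds)         ≡⟨ sum-δ 0F (λ j → valueAfter j ds) ⟩
    valueAfter 0F ds                                ∎
    where
    rows : ∀ a i x → valueAfter i (a ∷ x) ≡ ∑[ k < 11 ] (lookup (lookup (M a) i) k *q valueAfter k x)
    rows a i x = sym (trans (cong (λ row → ∑[ k < 11 ] (lookup row k *q valueAfter k x)) (rows-of-M a i))
                            (row-value (target a i) (target<22 a i) (target a i <? 11) x))
    w≡ : ∀ j → lookup wVec j ≡ valueAfter j []
    w≡ = tabulate-≡ (lookup wVec) (λ j → valueAfter j []) refl
    v≡ : ∀ j → lookup vVec j ≡ δ 0F j
    v≡ = tabulate-≡ (lookup vVec) (δ 0F) refl

open import Data.Nat using (ℕ)
open import Data.Integer using (+_)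
open import Data.Rational using (ℚ; _/_)
open import Data.Fin using (Fin)
open import Data.List using (List; length)
open import Data.List.Membership.Propositional using (_∈_)
open import Data.List.Relation.Unary.Unique.Propositional using (Unique)
open import Data.Product using (Σ; _×_)
open import Function.Bundles using (_⇔_)
open import Relation.Binary.PropositionalEquality using (_≡_)
open AbelianSquareCount using (abelianCount; card-abelianCount)
open LinearRepresentation using (linRep≡f)
open import Data.Product using (_,_)
open import Relation.Binary.PropositionalEquality using (cong; module ≡-Reasoning)

-- f(n) is the number of entries of a duplicate-free list of the abelian-square factors of length 2n,
-- and the linear representation evaluates to f(n) (leading zeros would not matter).
theorem9 : (n : ℕ) (ds : List (Fin 2)) → IsBase2Rep ds n →
    Σ (List Word) λ L → Unique L × ((u : Word) → (u ∈ L) ⇔ Counted n u)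
      × ((+ length L) / 1 ≡ linRep ds)
theorem9 n ds (value≡n , _) with card-abelianCount n
... | L , unique , members , length≡ = L , unique , members , (begin
  (+ length L) / 1                  ≡⟨ cong (λ c → (+ c) / 1) length≡ ⟩
  (+ abelianCount n) / 1            ≡⟨ cong (λ m → (+ abelianCount m) / 1) value≡n ⟨
  (+ abelianCount (value ds)) / 1   ≡⟨ linRep≡f ds ⟨
  linRep ds                         ∎)
  where open ≡-Reasoning
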